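{- Let $\lambda\vdash n$ be a partition with ${\rm aft}(\lambda)=k$. Then $f^\lambda\leq n^k/\sqrt{k!}$ and $f^\lambda\geq \binom{n-k}{k}$.
   Context: For $\lambda\vdash n$, ${\rm aft}(\lambda):=n-\max\{\lambda_1,\ell(\lambda)\}$, where $\lambda_1$ is the largest part and $\ell(\lambda)$ the number of nonzero parts. $f^\lambda$ denotes the number of standard Young tableaux of shape $\lambda$. -}

module Defs where

open import Data.Nat using (ℕ; zero; suc; _<_; _≥_; _⊔_; _∸_)
open import Data.Nat.ListAction using (sum)
open import Data.List using (List; []; _∷_; length; map; concat; upTo)
open import Data.List.Relation.Unary.All using (All)
open import Data.List.Relation.Unary.Linked using (Linked)
open import Data.List.Relation.Binary.Permutation.Propositional using (_↭_)
open import Data.Product using (_×_)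
open import Data.Unit using (⊤)
open import Data.Empty using (⊥)
open import Relation.Binary.PropositionalEquality using (_≡_)

IsPartition : ℕ → List ℕ → Set
IsPartition n λp = Linked _≥_ λp × All (λ x → 0 < x) λp × sum λp ≡ n

largestPart : List ℕ → ℕ
largestPart []      = 0
largestPart (x ∷ _) = x

aft : ℕ → List ℕ → ℕ
aft n λp = n ∸ (largestPart λp ⊔ length λp)

-- 'Above r r'' : row r' sits directly below row r (r' no longer than r)
-- and entries strictly increase down each column.
Above : List ℕ → List ℕ → Set
Above _        []       = ⊤
Above []       (_ ∷ _)  = ⊥
Above (x ∷ xs) (y ∷ ys) = (x < y) × Above xs ys

-- A standard Young tableau of shape λ (with n cells), given as its list of
-- rows; entries are 0,1,…,n-1 (each exactly once), rows strictly increase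
-- left to right, columns strictly increase top to bottom.
IsSYT : List ℕ → ℕ → List (List ℕ) → Set
IsSYT λp n T =
  (map length T ≡ λp) ×
  (concat T ↭ upTo n) ×
  All (Linked _<_) T ×
  Linked Above T

-- Let k = aft(λ) and let μ be λ without its first row or without its first
-- column, whichever is longer, so that |μ| = k and the removed row or column
-- has n − k cells. Sorting the standard tableaux of shape λ by the position of
-- their largest entry and inducting with Pascal's rule gives
-- C(n − k, k) ≤ f^λ ≤ C(n, k) f^μ. The relation D U − U D = I in Young's
-- lattice shows that summing f over the ends of all k-step growth paths from ∅
-- gives k!; the f^μ paths ending at μ contribute (f^μ)², so (f^μ)² ≤ k!.
-- With C(n, k) k! ≤ n^k this yields (f^λ)² k! ≤ n^(2k).

module Submission where

open import Defs
open import Data.Nat using (ℕ; _≤_; _*_; _^_; _∸_; _!)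
open import Data.Nat.Combinatorics using (_C_)
open import Data.List using (List; length)
open import Data.List.Relation.Unary.Unique.Propositional using (Unique)
open import Data.List.Membership.Propositional using (_∈_)
open import Data.Product using (_×_)
open import Function.Bundles using (_⇔_)

module RangeSum where

  open import Data.Nat
  open import Data.Nat.Properties
  open import Data.Bool using (Bool; true; false; if_then_else_)
  open import Data.Empty using (⊥-elim)
  open import Function using (_∘_)
  open import Relation.Binary.PropositionalEquality
  open import Algebra.Properties.CommutativeSemigroup +-commutativeSemigroup
    using (interchange; x∙yz≈y∙xz)

  ∑ : (ℕ → ℕ) → ℕ → ℕ
  ∑ f zero    = 0
  ∑ f (suc M) = f 0 + ∑ (f ∘ suc) M

  syntax ∑ (λ x → e) M = ∑[ x < M ] e

  when : Bool → ℕ → ℕ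
  when b c = if b then c else 0

  𝟙 : Bool → ℕ
  𝟙 b = when b 1

  ∑-cong : ∀ M {f g : ℕ → ℕ} → (∀ x → x < M → f x ≡ g x) → ∑ f M ≡ ∑ g M
  ∑-cong zero    h = refl
  ∑-cong (suc M) h = cong₂ _+_ (h 0 z<s) (∑-cong M (λ x x<M → h (suc x) (s<s x<M)))

  ∑-mono-≤ : ∀ M {f g : ℕ → ℕ} → (∀ x → x < M → f x ≤ g x) → ∑ f M ≤ ∑ g M
  ∑-mono-≤ zero    h = z≤n
  ∑-mono-≤ (suc M) h = +-mono-≤ (h 0 z<s) (∑-mono-≤ M (λ x x<M → h (suc x) (s<s x<M)))

  ∑-zero : ∀ M → ∑[ _ < M ] 0 ≡ 0
  ∑-zero zero    = refl
  ∑-zero (suc M) = ∑-zero M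

  ∑-≡0 : ∀ M {f : ℕ → ℕ} → (∀ x → x < M → f x ≡ 0) → ∑ f M ≡ 0
  ∑-≡0 M h = trans (∑-cong M h) (∑-zero M)

  ∑-+ : ∀ M (f g : ℕ → ℕ) → ∑[ x < M ] (f x + g x) ≡ ∑ f M + ∑ g M
  ∑-+ zero    f g = refl
  ∑-+ (suc M) f g =
    trans (cong (f 0 + g 0 +_) (∑-+ M (f ∘ suc) (g ∘ suc))) (interchange (f 0) (g 0) _ _)

  ∑-*ˡ : ∀ M c (f : ℕ → ℕ) → c * ∑ f M ≡ ∑[ x < M ] (c * f x)
  ∑-*ˡ zero    c f = *-zeroʳ c
  ∑-*ˡ (suc M) c f = trans (*-distribˡ-+ c (f 0) _) (cong (c * f 0 +_) (∑-*ˡ M c (f ∘ suc)))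

  ∑-comm : ∀ M M′ (f : ℕ → ℕ → ℕ) → ∑[ i < M ] ∑[ j < M′ ] f i j ≡ ∑[ j < M′ ] ∑[ i < M ] f i j
  ∑-comm zero    M′ f = sym (∑-zero M′)
  ∑-comm (suc M) M′ f = trans (cong (∑ (f 0) M′ +_) (∑-comm M M′ (f ∘ suc)))
                              (sym (∑-+ M′ (f 0) (λ j → ∑[ i < M ] f (suc i) j)))

  ∑-suc : ∀ M (f : ℕ → ℕ) → ∑ f (suc M) ≡ ∑ f M + f M
  ∑-suc zero    f = +-comm (f 0) 0
  ∑-suc (suc M) f = trans (cong (f 0 +_) (∑-suc M (f ∘ suc))) (sym (+-assoc (f 0) _ _))

  term≤∑ : ∀ M (f : ℕ → ℕ) p → p < M → f p ≤ ∑ f M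
  term≤∑ (suc M) f zero    _         = m≤m+n (f 0) _
  term≤∑ (suc M) f (suc p) (s<s p<M) = ≤-trans (term≤∑ M (f ∘ suc) p p<M) (m≤n+m _ (f 0))

  two-terms≤∑ : ∀ M (f : ℕ → ℕ) p q → p < M → q < M → p ≢ q → f p + f q ≤ ∑ f M
  two-terms≤∑ (suc M) f zero    zero    _         _         p≢q = ⊥-elim (p≢q refl)
  two-terms≤∑ (suc M) f zero    (suc q) _         (s<s q<M) _   = +-monoʳ-≤ (f 0) (term≤∑ M (f ∘ suc) q q<M)
  two-terms≤∑ (suc M) f (suc p) zero    (s<s p<M) _         _   =
    subst (_≤ ∑ f (suc M)) (+-comm (f 0) (f (suc p))) (+-monoʳ-≤ (f 0) (term≤∑ M (f ∘ suc) p p<M))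
  two-terms≤∑ (suc M) f (suc p) (suc q) (s<s p<M) (s<s q<M) p≢q =
    ≤-trans (two-terms≤∑ M (f ∘ suc) p q p<M q<M (p≢q ∘ cong suc)) (m≤n+m _ (f 0))

  ∑-singleton≤ : ∀ M p c → ∑[ x < M ] (if x ≡ᵇ p then c else 0) ≤ c
  ∑-singleton≤ zero    p       c = z≤n
  ∑-singleton≤ (suc M) zero    c = ≤-reflexive (trans (cong (c +_) (∑-zero M)) (+-identityʳ c))
  ∑-singleton≤ (suc M) (suc p) c = ∑-singleton≤ M p c

  ∑-pick : ∀ M (f : ℕ → ℕ) p → p < M → ∑ f M ≡ f p + ∑[ x < M ] (if x ≡ᵇ p then 0 else f x)
  ∑-pick (suc M) f zero    _         = refl
  ∑-pick (suc M) f (suc p) (s<s p<M) =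
    trans (cong (f 0 +_) (∑-pick M (f ∘ suc) p p<M)) (x∙yz≈y∙xz (f 0) (f (suc p)) _)

  when-∑ : ∀ M b (g : ℕ → ℕ) → when b (∑ g M) ≡ ∑[ x < M ] when b (g x)
  when-∑ M true  g = refl
  when-∑ M false g = sym (∑-zero M)

  when-comm : ∀ a b c → when a (when b c) ≡ when b (when a c)
  when-comm true  true  c = refl
  when-comm true  false c = refl
  when-comm false true  c = refl
  when-comm false false c = refl

  *-when : ∀ b c d → d * when b c ≡ when b (d * c)
  *-when true  c d = refl
  *-when false c d = *-zeroʳ d

  when-0 : ∀ b → when b 0 ≡ 0
  when-0 true  = refl
  when-0 false = refl

  when-cong : ∀ b {c d} → (b ≡ true → c ≡ d) → when b c ≡ when b d
  when-cong true  h = h refl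
  when-cong false h = refl

  when-mono-≤ : ∀ b {c d} → (b ≡ true → c ≤ d) → when b c ≤ when b d
  when-mono-≤ true  h = h refl
  when-mono-≤ false h = z≤n

  when-true : ∀ {b} c → b ≡ true → when b c ≡ c
  when-true c refl = refl

  when-false : ∀ {b} c → b ≡ false → when b c ≡ 0
  when-false c refl = refl

  when-+ : ∀ b c d → when b (c + d) ≡ when b c + when b d
  when-+ true  c d = refl
  when-+ false c d = refl

  ∑-when-const : ∀ M (p : ℕ → Bool) c → ∑[ x < M ] when (p x) c ≡ (∑[ x < M ] 𝟙 (p x)) * c
  ∑-when-const zero    p c = refl
  ∑-when-const (suc M) p c =
    trans (cong₂ _+_ (when≡𝟙* (p 0)) (∑-when-const M (p ∘ suc) c)) (sym (*-distribʳ-+ c (𝟙 (p 0)) _))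
    where
    when≡𝟙* : ∀ b → when b c ≡ 𝟙 b * c
    when≡𝟙* true  = sym (+-identityʳ c)
    when≡𝟙* false = refl

  ∑-when-split : ∀ M (p : ℕ → Bool) (x y : ℕ → ℕ) c → (∀ i → i < M → p i ≡ true → x i ≡ c + y i) →
    ∑[ i < M ] when (p i) (x i) ≡ (∑[ i < M ] 𝟙 (p i)) * c + ∑[ i < M ] when (p i) (y i)
  ∑-when-split M p x y c h = begin
      ∑[ i < M ] when (p i) (x i)
    ≡⟨ ∑-cong M (λ i i<M → trans (when-cong (p i) (h i i<M)) (when-+ (p i) c (y i))) ⟩
      ∑[ i < M ] (when (p i) c + when (p i) (y i))
    ≡⟨ ∑-+ M (λ i → when (p i) c) (λ i → when (p i) (y i)) ⟩
      ∑[ i < M ] when (p i) c + ∑[ i < M ] when (p i) (y i)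
    ≡⟨ cong (_+ ∑[ i < M ] when (p i) (y i)) (∑-when-const M p c) ⟩
      (∑[ i < M ] 𝟙 (p i)) * c + ∑[ i < M ] when (p i) (y i)
    ∎ where open ≡-Reasoning

  ∑-when-comm : ∀ M M′ (a b : ℕ → Bool) (D : ℕ → ℕ → ℕ) →
    ∑[ j < M ] when (a j) (∑[ i < M′ ] when (b i) (D j i)) ≡
    ∑[ i < M′ ] when (b i) (∑[ j < M ] when (a j) (D j i))
  ∑-when-comm M M′ a b D = begin
      ∑[ j < M ] when (a j) (∑[ i < M′ ] when (b i) (D j i))
    ≡⟨ ∑-cong M (λ j _ → when-∑ M′ (a j) _) ⟩
      ∑[ j < M ] ∑[ i < M′ ] when (a j) (when (b i) (D j i))
    ≡⟨ ∑-comm M M′ _ ⟩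
      ∑[ i < M′ ] ∑[ j < M ] when (a j) (when (b i) (D j i))
    ≡⟨ ∑-cong M′ (λ i _ → ∑-cong M (λ j _ → when-comm (a j) (b i) _)) ⟩
      ∑[ i < M′ ] ∑[ j < M ] when (b i) (when (a j) (D j i))
    ≡⟨ ∑-cong M′ (λ i _ → sym (when-∑ M (b i) _)) ⟩
      ∑[ i < M′ ] when (b i) (∑[ j < M ] when (a j) (D j i))
    ∎ where open ≡-Reasoning

  ∑-𝟙-< : ∀ M ℓ → ℓ ≤ M → ∑[ x < M ] 𝟙 (x <ᵇ ℓ) ≡ ℓ
  ∑-𝟙-< M       zero    _       = ∑-zero M
  ∑-𝟙-< (suc M) (suc ℓ) (s≤s h) = cong suc (∑-𝟙-< M ℓ h)

module YoungLattice (M : ℕ) where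

  open import Data.Nat
  open import Data.Nat.Properties
  open import Data.Bool using (Bool; true; false; if_then_else_; _∧_)
  open import Data.Bool.Properties using (T-≡)
  open import Data.Empty using (⊥-elim)
  open import Data.Sum using (inj₁; inj₂)
  open import Function using (_∘_)
  open import Function.Bundles using (Equivalence)
  open import Relation.Binary.PropositionalEquality
  open import Relation.Nullary using (yes; no)
  open RangeSum

  N : ℕ
  N = suc M

  -- A shape is the sequence of its row lengths. Corners are only looked for in
  -- rows below N and shapes are only compared on rows below N + 1, so every
  -- shape of interest has no cells in rows M and beyond.
  Shape : Set
  Shape = ℕ → ℕ

  removable : Shape → ℕ → Bool
  removable ν j = ν (suc j) <ᵇ ν j

  addable : Shape → ℕ → Bool
  addable ν zero    = true
  addable ν (suc i) = ν (suc i) <ᵇ ν i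

  addCell : Shape → ℕ → Shape
  addCell ν i x = if x ≡ᵇ i then suc (ν x) else ν x

  removeCell : Shape → ℕ → Shape
  removeCell ν j x = if x ≡ᵇ j then pred (ν x) else ν x

  all<ᵇ : (ℕ → Bool) → ℕ → Bool
  all<ᵇ p zero    = true
  all<ᵇ p (suc K) = p 0 ∧ all<ᵇ (p ∘ suc) K

  sameᵇ : Shape → Shape → Bool
  sameᵇ μ ν = all<ᵇ (λ x → μ x ≡ᵇ ν x) (suc N)

  ∅ : Shape
  ∅ _ = 0

  down : (Shape → ℕ) → Shape → ℕ
  down g ν = ∑[ j < N ] when (removable ν j) (g (removeCell ν j))

  up : (Shape → ℕ) → Shape → ℕ
  up g ν = ∑[ i < N ] when (addable ν i) (g (addCell ν i))

  -- chains t μ ν counts the ways of going from μ down to ν by t corner removals,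
  -- so f t μ is the number f^μ of standard tableaux of shape μ when t = |μ|.
  chains : ℕ → Shape → Shape → ℕ
  chains zero    μ ν = 𝟙 (sameᵇ μ ν)
  chains (suc t) μ ν = down (λ μ′ → chains t μ′ ν) μ

  f : ℕ → Shape → ℕ
  f t μ = chains t μ ∅

  cornerTerm : ℕ → Shape → ℕ → ℕ
  cornerTerm t μ j = when (removable μ j) (f t (removeCell μ j))

  Decreasing : Shape → Set
  Decreasing ν = ∀ x → ν (suc x) ≤ ν x

  VanishesFrom : ℕ → Shape → Set
  VanishesFrom m ν = ∀ x → m ≤ x → ν x ≡ 0

  Agree : Shape → Shape → Set
  Agree μ μ′ = ∀ x → x < suc N → μ x ≡ μ′ x

  ≡ᵇ-refl : ∀ x → (x ≡ᵇ x) ≡ true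
  ≡ᵇ-refl x = Equivalence.to T-≡ (≡⇒≡ᵇ x x refl)

  ≢⇒≡ᵇ≡false : ∀ x i → x ≢ i → (x ≡ᵇ i) ≡ false
  ≢⇒≡ᵇ≡false zero    zero    h = ⊥-elim (h refl)
  ≢⇒≡ᵇ≡false zero    (suc i) h = refl
  ≢⇒≡ᵇ≡false (suc x) zero    h = refl
  ≢⇒≡ᵇ≡false (suc x) (suc i) h = ≢⇒≡ᵇ≡false x i (h ∘ cong suc)

  <⇒<ᵇ≡true : ∀ {m n} → m < n → (m <ᵇ n) ≡ true
  <⇒<ᵇ≡true = Equivalence.to T-≡ ∘ <⇒<ᵇ

  <ᵇ≡true⇒< : ∀ m n → (m <ᵇ n) ≡ true → m < n
  <ᵇ≡true⇒< m n = <ᵇ⇒< m n ∘ Equivalence.from T-≡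

  ≥⇒<ᵇ≡false : ∀ {m n} → n ≤ m → (m <ᵇ n) ≡ false
  ≥⇒<ᵇ≡false {m}     {zero}  _       = refl
  ≥⇒<ᵇ≡false {suc m} {suc n} (s≤s h) = ≥⇒<ᵇ≡false h

  <ᵇ≡false⇒≥ : ∀ m n → (m <ᵇ n) ≡ false → n ≤ m
  <ᵇ≡false⇒≥ m       zero    _ = z≤n
  <ᵇ≡false⇒≥ (suc m) (suc n) h = s≤s (<ᵇ≡false⇒≥ m n h)

  ≡true-ext : ∀ {a b : Bool} → (a ≡ true → b ≡ true) → (b ≡ true → a ≡ true) → a ≡ b
  ≡true-ext {true}  {true}  _ _ = refl
  ≡true-ext {true}  {false} h _ = sym (h refl)
  ≡true-ext {false} {true}  _ h = h refl
  ≡true-ext {false} {false} _ _ = refl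

  ∧-true : ∀ {a b : Bool} → a ≡ true → b ≡ true → (a ∧ b) ≡ true
  ∧-true refl refl = refl

  ∧-trueˡ : ∀ {a b : Bool} → (a ∧ b) ≡ true → a ≡ true
  ∧-trueˡ {true} _ = refl

  ∧-trueʳ : ∀ {a b : Bool} → (a ∧ b) ≡ true → b ≡ true
  ∧-trueʳ {true} h = h

  when-∧ : ∀ a b c → when a (when b c) ≡ when (a ∧ b) c
  when-∧ true  b c = refl
  when-∧ false b c = refl

  if-≢ : ∀ x i (c d : ℕ) → x ≢ i → (if x ≡ᵇ i then c else d) ≡ d
  if-≢ x i c d h rewrite ≢⇒≡ᵇ≡false x i h = refl

  if-≡ : ∀ x (c d : ℕ) → (if x ≡ᵇ x then c else d) ≡ c
  if-≡ x c d rewrite ≡ᵇ-refl x = refl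

  addCell-at : ∀ ν i → addCell ν i i ≡ suc (ν i)
  addCell-at ν i = if-≡ i _ _

  addCell-off : ∀ ν i x → x ≢ i → addCell ν i x ≡ ν x
  addCell-off ν i x h = if-≢ x i _ _ h

  removeCell-at : ∀ ν j → removeCell ν j j ≡ pred (ν j)
  removeCell-at ν j = if-≡ j _ _

  removeCell-off : ∀ ν j x → x ≢ j → removeCell ν j x ≡ ν x
  removeCell-off ν j x h = if-≢ x j _ _ h

  addCell-below : ∀ ν i → addCell ν i (suc i) ≡ ν (suc i)
  addCell-below ν i = addCell-off ν i (suc i) 1+n≢n

  addCell-above : ∀ ν i → addCell ν (suc i) i ≡ ν i
  addCell-above ν i = addCell-off ν (suc i) i (1+n≢n ∘ sym)

  removeCell-below : ∀ ν j → removeCell ν j (suc j) ≡ ν (suc j)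
  removeCell-below ν j = removeCell-off ν j (suc j) 1+n≢n

  removeCell-above : ∀ ν j → removeCell ν (suc j) j ≡ ν j
  removeCell-above ν j = removeCell-off ν (suc j) j (1+n≢n ∘ sym)

  removeCell-≤ : ∀ ν j x → removeCell ν j x ≤ ν x
  removeCell-≤ ν j x with x ≟ j
  ... | yes refl = subst (_≤ ν x) (sym (removeCell-at ν x)) pred[n]≤n
  ... | no ne = ≤-reflexive (removeCell-off ν j x ne)

  addCell-≥ : ∀ ν i x → ν x ≤ addCell ν i x
  addCell-≥ ν i x with x ≟ i
  ... | yes refl = subst (ν x ≤_) (sym (addCell-at ν x)) (n≤1+n _)
  ... | no ne = ≤-reflexive (sym (addCell-off ν i x ne))

  all<ᵇ⇒ : ∀ K p → all<ᵇ p K ≡ true → ∀ x → x < K → p x ≡ true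
  all<ᵇ⇒ (suc K) p h zero _ = ∧-trueˡ h
  all<ᵇ⇒ (suc K) p h (suc x) (s<s x<K) = all<ᵇ⇒ K (p ∘ suc) (∧-trueʳ {p 0} h) x x<K

  ⇒all<ᵇ : ∀ K p → (∀ x → x < K → p x ≡ true) → all<ᵇ p K ≡ true
  ⇒all<ᵇ zero p h = refl
  ⇒all<ᵇ (suc K) p h = ∧-true (h 0 z<s) (⇒all<ᵇ K (p ∘ suc) (λ x x<K → h (suc x) (s<s x<K)))

  all<ᵇ-cong : ∀ K p q → (∀ x → x < K → p x ≡ q x) → all<ᵇ p K ≡ all<ᵇ q K
  all<ᵇ-cong zero p q h = refl
  all<ᵇ-cong (suc K) p q h = cong₂ _∧_ (h 0 z<s) (all<ᵇ-cong K _ _ (λ x x<K → h (suc x) (s<s x<K)))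

  sameᵇ⇒agree : ∀ μ ν → sameᵇ μ ν ≡ true → ∀ x → x < suc N → μ x ≡ ν x
  sameᵇ⇒agree μ ν h x x< = ≡ᵇ⇒≡ (μ x) (ν x) (Equivalence.from T-≡ (all<ᵇ⇒ (suc N) (λ y → μ y ≡ᵇ ν y) h x x<))

  agree⇒sameᵇ : ∀ μ ν → (∀ x → x < suc N → μ x ≡ ν x) → sameᵇ μ ν ≡ true
  agree⇒sameᵇ μ ν h = ⇒all<ᵇ (suc N) _ (λ x x< → subst (λ z → (μ x ≡ᵇ z) ≡ true) (h x x<) (≡ᵇ-refl (μ x)))

  sameᵇ-false : ∀ μ ν x → x < suc N → μ x ≢ ν x → sameᵇ μ ν ≡ false
  sameᵇ-false μ ν x x< ne with sameᵇ μ ν in e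
  ... | true = ⊥-elim (ne (sameᵇ⇒agree μ ν e x x<))
  ... | false = refl

  removeCell-agree : ∀ μ μ' j → Agree μ μ' → Agree (removeCell μ j) (removeCell μ' j)
  removeCell-agree μ μ' j h x x< with x ≡ᵇ j
  ... | true = cong pred (h x x<)
  ... | false = h x x<

  addCell-agree : ∀ μ μ′ i → Agree μ μ′ → Agree (addCell μ i) (addCell μ′ i)
  addCell-agree μ μ′ i h x x< with x ≡ᵇ i
  ... | true  = cong suc (h x x<)
  ... | false = h x x<

  chains-cong : ∀ t μ μ' ν → Agree μ μ' → chains t μ ν ≡ chains t μ' ν
  chains-cong zero μ μ' ν h = cong 𝟙 (all<ᵇ-cong (suc N) _ _ (λ x x< → cong (_≡ᵇ ν x) (h x x<)))
  chains-cong (suc t) μ μ' ν h = ∑-cong N (λ j j< →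
    cong₂ when (cong₂ _<ᵇ_ (h (suc j) (s<s j<)) (h j (m<n⇒m<1+n j<)))
               (chains-cong t (removeCell μ j) (removeCell μ' j) ν (removeCell-agree μ μ' j h)))

  f-cong : ∀ t μ μ' → (∀ x → μ x ≡ μ' x) → f t μ ≡ f t μ'
  f-cong t μ μ' h = chains-cong t μ μ' ∅ (λ x _ → h x)

  removeCell-addCell : ∀ ν i x → removeCell (addCell ν i) i x ≡ ν x
  removeCell-addCell ν i x with x ≟ i
  ... | yes refl = trans (removeCell-at (addCell ν x) x) (cong pred (addCell-at ν x))
  ... | no ne = trans (removeCell-off (addCell ν i) i x ne) (addCell-off ν i x ne)

  addCell-removeCell : ∀ ν j → 1 ≤ ν j → ∀ x → addCell (removeCell ν j) j x ≡ ν x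
  addCell-removeCell ν j h x with x ≟ j
  ... | yes refl = trans (addCell-at (removeCell ν x) x) (trans (cong suc (removeCell-at ν x)) (suc-pred (ν x) {{>-nonZero h}}))
  ... | no ne = trans (addCell-off (removeCell ν j) j x ne) (removeCell-off ν j x ne)

  addCell-removeCell-comm : ∀ ν i j → i ≢ j → ∀ x → removeCell (addCell ν i) j x ≡ addCell (removeCell ν j) i x
  addCell-removeCell-comm ν i j ij x with x ≟ i | x ≟ j
  ... | yes refl | yes refl = ⊥-elim (ij refl)
  ... | yes refl | no nj = trans (removeCell-off (addCell ν x) j x nj) (trans (addCell-at ν x)
          (sym (trans (addCell-at (removeCell ν j) x) (cong suc (removeCell-off ν j x nj)))))
  ... | no ni | yes refl = trans (removeCell-at (addCell ν i) x) (trans (cong pred (addCell-off ν i x ni))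
          (sym (trans (addCell-off (removeCell ν x) i x ni) (removeCell-at ν x))))
  ... | no ni | no nj = trans (removeCell-off (addCell ν i) j x nj) (trans (addCell-off ν i x ni)
          (sym (trans (addCell-off (removeCell ν j) i x ni) (removeCell-off ν j x nj))))

  removable⇒pos : ∀ ν j → removable ν j ≡ true → 1 ≤ ν j
  removable⇒pos ν j h = ≤-trans (s≤s z≤n) (<ᵇ≡true⇒< _ _ h)

  Decreasing-removeCell : ∀ ν j → Decreasing ν → removable ν j ≡ true → Decreasing (removeCell ν j)
  Decreasing-removeCell ν j P r x with x ≟ j | suc x ≟ j
  ... | yes refl | _ = subst₂ _≤_ (sym (removeCell-below ν x)) (sym (removeCell-at ν x))
          (≤-pred (subst (suc (ν (suc x)) ≤_) (sym (suc-pred (ν x) {{>-nonZero (removable⇒pos ν x r)}})) (<ᵇ≡true⇒< _ _ r)))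
  ... | no _ | yes refl = subst₂ _≤_ (sym (removeCell-at ν (suc x))) (sym (removeCell-above ν x))
          (≤-trans pred[n]≤n (P x))
  ... | no nx | no nsx = subst₂ _≤_ (sym (removeCell-off ν j (suc x) nsx)) (sym (removeCell-off ν j x nx)) (P x)

  Decreasing-addCell : ∀ ν i → Decreasing ν → addable ν i ≡ true → Decreasing (addCell ν i)
  Decreasing-addCell ν i P a x with x ≟ i | suc x ≟ i
  ... | yes refl | _ = subst₂ _≤_ (sym (addCell-below ν x)) (sym (addCell-at ν x))
          (≤-trans (P x) (n≤1+n _))
  ... | no _ | yes refl = subst₂ _≤_ (sym (addCell-at ν (suc x))) (sym (addCell-above ν x))
          (<ᵇ≡true⇒< _ _ a)
  ... | no nx | no nsx = subst₂ _≤_ (sym (addCell-off ν i (suc x) nsx)) (sym (addCell-off ν i x nx)) (P x)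

  Vanishes-removeCell : ∀ m ν j → VanishesFrom m ν → VanishesFrom m (removeCell ν j)
  Vanishes-removeCell m ν j V x mx = n≤0⇒n≡0 (subst (removeCell ν j x ≤_) (V x mx) (removeCell-≤ ν j x))

  Vanishes-mono : ∀ m m' ν → m ≤ m' → VanishesFrom m ν → VanishesFrom m' ν
  Vanishes-mono m m' ν le V x mx = V x (≤-trans le mx)

  Vanishes-addCell : ∀ m ν i → VanishesFrom m ν → addable ν i ≡ true → VanishesFrom (suc m) (addCell ν i)
  Vanishes-addCell m ν i V a x mx with x ≟ i
  ... | no ne = trans (addCell-off ν i x ne) (V x (≤-trans (n≤1+n m) mx))
  Vanishes-addCell m ν zero V a zero () | yes refl
  Vanishes-addCell m ν (suc i) V a (suc i) (s≤s mx) | yes refl =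
    ⊥-elim (n≮0 (subst (ν (suc i) <_) (V i mx) (<ᵇ≡true⇒< _ _ a)))

  Decreasing-antitone : ∀ ν → Decreasing ν → ∀ {x y} → x ≤ y → ν y ≤ ν x
  Decreasing-antitone ν P {y = zero}  z≤n   = ≤-refl
  Decreasing-antitone ν P {y = suc y} x≤1+y with m≤n⇒m<n∨m≡n x≤1+y
  ... | inj₁ x<1+y = ≤-trans (P y) (Decreasing-antitone ν P (≤-pred x<1+y))
  ... | inj₂ refl  = ≤-refl

  down-cong : ∀ g h ν → (∀ j → removable ν j ≡ true → g (removeCell ν j) ≡ h (removeCell ν j)) →
              down g ν ≡ down h ν
  down-cong g h ν gh = ∑-cong N (λ j _ → when-cong (removable ν j) (gh j))

  up-cong : ∀ g h ν → (∀ i → addable ν i ≡ true → g (addCell ν i) ≡ h (addCell ν i)) → up g ν ≡ up h ν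
  up-cong g h ν gh = ∑-cong N (λ i _ → when-cong (addable ν i) (gh i))

  up-mono-≤ : ∀ g h ν → (∀ i → addable ν i ≡ true → g (addCell ν i) ≤ h (addCell ν i)) → up g ν ≤ up h ν
  up-mono-≤ g h ν gh = ∑-mono-≤ N (λ i _ → when-mono-≤ (addable ν i) (gh i))

  down-*ˡ : ∀ c g ν → down (λ μ → c * g μ) ν ≡ c * down g ν
  down-*ˡ c g ν = trans (∑-cong N (λ j _ → sym (*-when (removable ν j) (g (removeCell ν j)) c)))
                        (sym (∑-*ˡ N c (λ j → when (removable ν j) (g (removeCell ν j)))))

  up-*ˡ : ∀ c g ν → up (λ μ → c * g μ) ν ≡ c * up g ν
  up-*ˡ c g ν = trans (∑-cong N (λ i _ → sym (*-when (addable ν i) (g (addCell ν i)) c)))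
                      (sym (∑-*ˡ N c (λ i → when (addable ν i) (g (addCell ν i)))))

  up-*ʳ : ∀ c g ν → up g ν * c ≡ up (λ μ → g μ * c) ν
  up-*ʳ c g ν = trans (*-comm (up g ν) c) (trans (sym (up-*ˡ c g ν)) (up-cong (λ μ → c * g μ) (λ μ → g μ * c) ν (λ i _ → *-comm c (g (addCell ν i)))))

module DownUp (M : ℕ) where

  open import Data.Nat
  open import Data.Nat.Properties
  open import Data.Bool using (true; if_then_else_; _∧_)
  open import Relation.Binary.PropositionalEquality
  open import Relation.Nullary using (yes; no)
  open RangeSum
  open YoungLattice M

  Extensional : (Shape → ℕ) → Set
  Extensional g = ∀ μ μ′ → (∀ x → μ x ≡ μ′ x) → g μ ≡ g μ′

  #addable : Shape → ℕ
  #addable ν = ∑[ i < N ] 𝟙 (addable ν i)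

  #removable : Shape → ℕ
  #removable ν = ∑[ j < N ] 𝟙 (removable ν j)

  -- A cell can always be added to row 0, and to row j + 1 exactly when one can
  -- be removed from row j; row M has no removable cell.
  #addable≡1+#removable : ∀ ν → VanishesFrom M ν → #addable ν ≡ suc (#removable ν)
  #addable≡1+#removable ν V = cong suc (sym (begin
      ∑[ j < N ] 𝟙 (removable ν j)
    ≡⟨ ∑-suc M (λ j → 𝟙 (removable ν j)) ⟩
      ∑[ j < M ] 𝟙 (removable ν j) + 𝟙 (removable ν M)
    ≡⟨ cong (λ b → ∑[ j < M ] 𝟙 (removable ν j) + 𝟙 b) (≥⇒<ᵇ≡false (subst (_≤ ν (suc M)) (sym (V M ≤-refl)) z≤n)) ⟩
      ∑[ j < M ] 𝟙 (removable ν j) + 0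
    ≡⟨ +-identityʳ _ ⟩
      ∑[ j < M ] 𝟙 (removable ν j)
    ∎)) where open ≡-Reasoning

  pred< : ∀ {n} → 1 ≤ n → pred n < n
  pred< {suc n} _ = n<1+n n

  1+m<n⇒m<pred-n : ∀ {a b} → suc a < b → a < pred b
  1+m<n⇒m<pred-n = pred-mono-<

  m<pred-n⇒1+m<n : ∀ {a b} → a < pred b → suc a < b
  m<pred-n⇒1+m<n {a} = pred-cancel-< {suc a}

  removable-addCell : ∀ ν i → Decreasing ν → removable (addCell ν i) i ≡ true
  removable-addCell ν i P =
    <⇒<ᵇ≡true (subst₂ _<_ (sym (addCell-below ν i)) (sym (addCell-at ν i)) (s≤s (P i)))

  addable-removeCell : ∀ ν j → Decreasing ν → removable ν j ≡ true → addable (removeCell ν j) j ≡ true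
  addable-removeCell ν zero    P r = refl
  addable-removeCell ν (suc j) P r = <⇒<ᵇ≡true (subst₂ _<_ (sym (removeCell-at ν (suc j))) (sym (removeCell-above ν j))
    (<-≤-trans (pred< (removable⇒pos ν (suc j) r)) (P j)))

  addable-removable-comm : ∀ ν i j → i ≢ j →
    (addable ν i ∧ removable (addCell ν i) j) ≡ (removable ν j ∧ addable (removeCell ν j) i)
  addable-removable-comm ν i j i≢j = ≡true-ext add-first remove-first
    where
    j≢i : j ≢ i
    j≢i e = i≢j (sym e)

    add-first : (addable ν i ∧ removable (addCell ν i) j) ≡ true → (removable ν j ∧ addable (removeCell ν j) i) ≡ true
    add-first h = ∧-true (<⇒<ᵇ≡true (≤-trans (s≤s (addCell-≥ ν i (suc j))) below<νj)) (still-addable i i≢j (∧-trueˡ h) below<νj)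
      where
      below<νj : addCell ν i (suc j) < ν j
      below<νj = subst (addCell ν i (suc j) <_) (addCell-off ν i j j≢i) (<ᵇ≡true⇒< _ _ (∧-trueʳ {addable ν i} h))
      still-addable : ∀ i → i ≢ j → addable ν i ≡ true → addCell ν i (suc j) < ν j → addable (removeCell ν j) i ≡ true
      still-addable zero     _    _ _ = refl
      still-addable (suc i′) i≢j′ a lt with i′ ≟ j
      ... | yes refl = <⇒<ᵇ≡true (subst₂ _<_ (sym (removeCell-below ν i′)) (sym (removeCell-at ν i′))
                                   (1+m<n⇒m<pred-n (subst (_< ν i′) (addCell-at ν (suc i′)) lt)))
      ... | no i′≢j  = <⇒<ᵇ≡true (subst₂ _<_ (sym (removeCell-off ν j (suc i′) i≢j′)) (sym (removeCell-off ν j i′ i′≢j))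
                                   (<ᵇ≡true⇒< _ _ a))

    remove-first : (removable ν j ∧ addable (removeCell ν j) i) ≡ true → (addable ν i ∧ removable (addCell ν i) j) ≡ true
    remove-first h = ∧-true (was-addable i i≢j a) (<⇒<ᵇ≡true (subst (addCell ν i (suc j) <_) (sym (addCell-off ν i j j≢i)) (below<νj i a)))
      where
      a : addable (removeCell ν j) i ≡ true
      a = ∧-trueʳ {removable ν j} h
      was-addable : ∀ i → i ≢ j → addable (removeCell ν j) i ≡ true → addable ν i ≡ true
      was-addable zero     _    _ = refl
      was-addable (suc i′) i≢j′ a = <⇒<ᵇ≡true (≤-trans
        (subst (λ z → suc z ≤ removeCell ν j i′) (removeCell-off ν j (suc i′) i≢j′) (<ᵇ≡true⇒< _ _ a)) (removeCell-≤ ν j i′))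
      below<νj : ∀ i → addable (removeCell ν j) i ≡ true → addCell ν i (suc j) < ν j
      below<νj i a with suc j ≟ i
      below<νj .(suc j) a | yes refl = subst (_< ν j) (sym (addCell-at ν (suc j)))
        (m<pred-n⇒1+m<n (subst₂ _<_ (removeCell-below ν j) (removeCell-at ν j) (<ᵇ≡true⇒< _ _ a)))
      ... | no 1+j≢i = subst (_< ν j) (sym (addCell-off ν i (suc j) 1+j≢i)) (<ᵇ≡true⇒< _ _ (∧-trueˡ h))

  addRemove : (Shape → ℕ) → Shape → ℕ → ℕ → ℕ
  addRemove g ν i j = if j ≡ᵇ i then 0 else when (removable (addCell ν i) j) (g (removeCell (addCell ν i) j))

  removeAdd : (Shape → ℕ) → Shape → ℕ → ℕ → ℕ
  removeAdd g ν j i = if i ≡ᵇ j then 0 else when (addable (removeCell ν j) i) (g (addCell (removeCell ν j) i))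

  upDownRest : (Shape → ℕ) → Shape → ℕ
  upDownRest g ν = ∑[ i < N ] when (addable ν i) (∑[ j < N ] addRemove g ν i j)

  downUpRest : (Shape → ℕ) → Shape → ℕ
  downUpRest g ν = ∑[ j < N ] when (removable ν j) (∑[ i < N ] removeAdd g ν j i)

  up-down-split : ∀ g ν → Extensional g → Decreasing ν → up (down g) ν ≡ #addable ν * g ν + upDownRest g ν
  up-down-split g ν ext P = ∑-when-split N (addable ν) (λ i → down g (addCell ν i)) (λ i → ∑[ j < N ] addRemove g ν i j) (g ν)
    (λ i i<N _ → trans (∑-pick N (λ j → when (removable (addCell ν i) j) (g (removeCell (addCell ν i) j))) i i<N)
                       (cong (_+ ∑[ j < N ] addRemove g ν i j) (trans (when-true _ (removable-addCell ν i P)) (ext _ _ (removeCell-addCell ν i)))))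

  down-up-split : ∀ g ν → Extensional g → Decreasing ν → down (up g) ν ≡ #removable ν * g ν + downUpRest g ν
  down-up-split g ν ext P = ∑-when-split N (removable ν) (λ j → up g (removeCell ν j)) (λ j → ∑[ i < N ] removeAdd g ν j i) (g ν)
    (λ j j<N r → trans (∑-pick N (λ i → when (addable (removeCell ν j) i) (g (addCell (removeCell ν j) i))) j j<N)
                       (cong (_+ ∑[ i < N ] removeAdd g ν j i) (trans (when-true _ (addable-removeCell ν j P r))
                                           (ext _ _ (addCell-removeCell ν j (removable⇒pos ν j r))))))

  upDownRest≡downUpRest : ∀ g ν → Extensional g → upDownRest g ν ≡ downUpRest g ν
  upDownRest≡downUpRest g ν ext = begin
      upDownRest g ν
    ≡⟨ ∑-cong N (λ i _ → when-∑ N (addable ν i) (addRemove g ν i)) ⟩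
      ∑[ i < N ] ∑[ j < N ] when (addable ν i) (addRemove g ν i j)
    ≡⟨ ∑-comm N N (λ i j → when (addable ν i) (addRemove g ν i j)) ⟩
      ∑[ j < N ] ∑[ i < N ] when (addable ν i) (addRemove g ν i j)
    ≡⟨ ∑-cong N (λ j _ → ∑-cong N (λ i _ → term i j)) ⟩
      ∑[ j < N ] ∑[ i < N ] when (removable ν j) (removeAdd g ν j i)
    ≡⟨ ∑-cong N (λ j _ → sym (when-∑ N (removable ν j) (removeAdd g ν j))) ⟩
      downUpRest g ν
    ∎
    where
    open ≡-Reasoning
    term : ∀ i j → when (addable ν i) (addRemove g ν i j) ≡ when (removable ν j) (removeAdd g ν j i)
    term i j with i ≟ j
    ... | yes refl = trans (cong (when (addable ν i)) (if-≡ i 0 _)) (trans (when-0 (addable ν i))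
          (sym (trans (cong (when (removable ν i)) (if-≡ i 0 _)) (when-0 (removable ν i)))))
    ... | no ne = trans (cong (when (addable ν i)) (if-≢ j i 0 _ (λ e → ne (sym e))))
      (trans (when-∧ (addable ν i) _ _) (trans (cong₂ when (addable-removable-comm ν i j ne) (ext _ _ (addCell-removeCell-comm ν i j ne)))
        (sym (trans (cong (when (removable ν j)) (if-≢ i j 0 _ ne)) (when-∧ (removable ν j) _ _)))))

  -- The relation D U − U D = I of Young's lattice, read on functions of shapes.
  up-down-comm : ∀ g ν → Extensional g → Decreasing ν → VanishesFrom M ν → up (down g) ν ≡ g ν + down (up g) ν
  up-down-comm g ν ext P V = begin
      up (down g) ν
    ≡⟨ up-down-split g ν ext P ⟩
      #addable ν * g ν + upDownRest g ν
    ≡⟨ cong₂ _+_ (cong (_* g ν) (#addable≡1+#removable ν V)) (upDownRest≡downUpRest g ν ext) ⟩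
      (g ν + #removable ν * g ν) + downUpRest g ν
    ≡⟨ +-assoc (g ν) _ _ ⟩
      g ν + (#removable ν * g ν + downUpRest g ν)
    ≡⟨ cong (g ν +_) (sym (down-up-split g ν ext P)) ⟩
      g ν + down (up g) ν
    ∎ where open ≡-Reasoning

  up-f-zero : ∀ ν → up (f 0) ν ≡ 0
  up-f-zero ν = ∑-≡0 N (λ i i<N → trans (cong (λ b → when (addable ν i) (𝟙 b))
    (sameᵇ-false (addCell ν i) ∅ i (m<n⇒m<1+n i<N) (λ e → 1+n≢0 (trans (sym (addCell-at ν i)) e)))) (when-0 _))

  up-f : ∀ s ν → Decreasing ν → VanishesFrom M ν → up (f (suc s)) ν ≡ suc s * f s ν
  down-up-f : ∀ s ν → Decreasing ν → VanishesFrom M ν → down (up (f s)) ν ≡ s * f s ν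

  up-f s ν P V = trans (up-down-comm (f s) ν (f-cong s) P V) (cong (f s ν +_) (down-up-f s ν P V))

  down-up-f zero    ν P V = ∑-≡0 N (λ j _ → trans (cong (when (removable ν j)) (up-f-zero (removeCell ν j))) (when-0 _))
  down-up-f (suc s) ν P V = trans
    (down-cong (up (f (suc s))) (λ μ → suc s * f s μ) ν (λ j r → up-f s (removeCell ν j) (Decreasing-removeCell ν j P r) (Vanishes-removeCell M ν j V)))
    (down-*ˡ (suc s) (f s) ν)

module SquareBound (M : ℕ) where

  open import Data.Nat
  open import Data.Nat.Properties
  open import Data.Bool using (true; false)
  open import Relation.Binary.PropositionalEquality
  open RangeSum
  open YoungLattice M
  open DownUp M

  upSum : ℕ → ℕ → Shape → ℕ
  upSum zero    s = f s
  upSum (suc t) s = up (upSum t (suc s))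

  rising : ℕ → ℕ → ℕ
  rising s zero    = 1
  rising s (suc t) = suc s * rising (suc s) t

  upSum≡rising*f : ∀ t s ν m → Decreasing ν → VanishesFrom m ν → m + t ≤ M → upSum t s ν ≡ rising s t * f s ν
  upSum≡rising*f zero    s ν m P V le = sym (*-identityˡ (f s ν))
  upSum≡rising*f (suc t) s ν m P V le = begin
      up (upSum t (suc s)) ν
    ≡⟨ up-cong (upSum t (suc s)) (λ μ → rising (suc s) t * f (suc s) μ) ν (λ i a → upSum≡rising*f t (suc s) (addCell ν i) (suc m) (Decreasing-addCell ν i P a)
                           (Vanishes-addCell m ν i V a) (subst (_≤ M) (+-suc m t) le)) ⟩
      up (λ μ → rising (suc s) t * f (suc s) μ) ν
    ≡⟨ up-*ˡ (rising (suc s) t) (f (suc s)) ν ⟩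
      rising (suc s) t * up (f (suc s)) ν
    ≡⟨ cong (rising (suc s) t *_) (up-f s ν P (Vanishes-mono m M ν (≤-trans (m≤m+n m (suc t)) le) V)) ⟩
      rising (suc s) t * (suc s * f s ν)
    ≡⟨ sym (*-assoc (rising (suc s) t) (suc s) (f s ν)) ⟩
      (rising (suc s) t * suc s) * f s ν
    ≡⟨ cong (_* f s ν) (*-comm (rising (suc s) t) (suc s)) ⟩
      rising s (suc t) * f s ν
    ∎ where open ≡-Reasoning

  !*rising≡! : ∀ s t → s ! * rising s t ≡ (s + t) !
  !*rising≡! s zero = trans (*-identityʳ (s !)) (cong _! (sym (+-identityʳ s)))
  !*rising≡! s (suc t) = begin
      s ! * (suc s * rising (suc s) t)
    ≡⟨ sym (*-assoc (s !) (suc s) _) ⟩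
      (s ! * suc s) * rising (suc s) t
    ≡⟨ cong (_* rising (suc s) t) (*-comm (s !) (suc s)) ⟩
      (suc s) ! * rising (suc s) t
    ≡⟨ !*rising≡! (suc s) t ⟩
      (suc s + t) !
    ≡⟨ cong _! (sym (+-suc s t)) ⟩
      (s + suc t) !
    ∎ where open ≡-Reasoning

  rising-0 : ∀ k → rising 0 k ≡ k !
  rising-0 k = trans (sym (+-identityʳ (rising 0 k))) (!*rising≡! 0 k)

  removeCell⇒addable : ∀ μ ν j → Decreasing μ → j < N → removable μ j ≡ true → Agree (removeCell μ j) ν →
                       addable ν j ≡ true
  removeCell⇒addable μ ν zero    P _   _ _  = refl
  removeCell⇒addable μ ν (suc j) P j<N r ag = <⇒<ᵇ≡true (subst₂ _<_
    (trans (sym (removeCell-at μ (suc j))) (ag (suc j) (m<n⇒m<1+n j<N)))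
    (trans (sym (removeCell-above μ j)) (ag j (m<n⇒m<1+n (<-trans (n<1+n j) j<N))))
    (<-≤-trans (pred< (removable⇒pos μ (suc j) r)) (P j)))

  removeCell⇒agree-addCell : ∀ μ ν j → removable μ j ≡ true → Agree (removeCell μ j) ν → Agree μ (addCell ν j)
  removeCell⇒agree-addCell μ ν j r ag x x< =
    trans (sym (addCell-removeCell μ j (removable⇒pos μ j r) x)) (addCell-agree (removeCell μ j) ν j ag x x<)

  -- A chain from μ down to ν can also be enumerated by its bottom step.
  chains-suc≤up : ∀ t μ ν → Decreasing μ → chains (suc t) μ ν ≤ up (chains t μ) ν
  chains-suc≤up zero μ ν P = ∑-mono-≤ N term
    where
    term : ∀ j → j < N → when (removable μ j) (𝟙 (sameᵇ (removeCell μ j) ν)) ≤ when (addable ν j) (𝟙 (sameᵇ μ (addCell ν j)))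
    term j j<N with removable μ j in r | sameᵇ (removeCell μ j) ν in e
    ... | false | _     = z≤n
    ... | true  | false = z≤n
    ... | true  | true
      rewrite removeCell⇒addable μ ν j P j<N r (sameᵇ⇒agree _ _ e)
            | agree⇒sameᵇ μ (addCell ν j) (removeCell⇒agree-addCell μ ν j r (sameᵇ⇒agree _ _ e)) = ≤-refl
  chains-suc≤up (suc t) μ ν P = begin
      down (λ μ′ → chains (suc t) μ′ ν) μ
    ≤⟨ ∑-mono-≤ N (λ j _ → when-mono-≤ (removable μ j) (λ r → chains-suc≤up t (removeCell μ j) ν (Decreasing-removeCell μ j P r))) ⟩
      ∑[ j < N ] when (removable μ j) (∑[ i < N ] when (addable ν i) (chains t (removeCell μ j) (addCell ν i)))
    ≡⟨ ∑-when-comm N N (removable μ) (addable ν) (λ j i → chains t (removeCell μ j) (addCell ν i)) ⟩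
      up (chains (suc t) μ) ν
    ∎ where open ≤-Reasoning

  chains*f≤upSum : ∀ t s ν μ → Decreasing μ → chains t μ ν * f (t + s) μ ≤ upSum t s ν
  chains*f≤upSum zero s ν μ P with sameᵇ μ ν in e
  ... | false = z≤n
  ... | true  = ≤-reflexive (trans (+-identityʳ _) (chains-cong s μ ν ∅ (sameᵇ⇒agree μ ν e)))
  chains*f≤upSum (suc t) s ν μ P = begin
      chains (suc t) μ ν * f (suc t + s) μ
    ≡⟨ cong (λ z → chains (suc t) μ ν * f z μ) (sym (+-suc t s)) ⟩
      chains (suc t) μ ν * f (t + suc s) μ
    ≤⟨ *-monoˡ-≤ (f (t + suc s) μ) (chains-suc≤up t μ ν P) ⟩
      up (chains t μ) ν * f (t + suc s) μ
    ≡⟨ up-*ʳ (f (t + suc s) μ) (chains t μ) ν ⟩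
      up (λ ν′ → chains t μ ν′ * f (t + suc s) μ) ν
    ≤⟨ up-mono-≤ (λ ν′ → chains t μ ν′ * f (t + suc s) μ) (upSum t (suc s)) ν (λ i _ → chains*f≤upSum t (suc s) (addCell ν i) μ P) ⟩
      up (upSum t (suc s)) ν
    ∎ where open ≤-Reasoning

  f-∅ : f 0 ∅ ≡ 1
  f-∅ = cong 𝟙 (agree⇒sameᵇ ∅ ∅ (λ _ _ → refl))

  f²≤! : ∀ k μ → Decreasing μ → k ≤ M → f k μ * f k μ ≤ k !
  f²≤! k μ P le = begin
      f k μ * f k μ
    ≡⟨ cong (λ z → f k μ * f z μ) (sym (+-identityʳ k)) ⟩
      chains k μ ∅ * f (k + 0) μ
    ≤⟨ chains*f≤upSum k 0 ∅ μ P ⟩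
      upSum k 0 ∅
    ≡⟨ upSum≡rising*f k 0 ∅ 0 (λ _ → z≤n) (λ _ _ → refl) le ⟩
      rising 0 k * f 0 ∅
    ≡⟨ cong₂ _*_ (rising-0 k) f-∅ ⟩
      k ! * 1
    ≡⟨ *-identityʳ (k !) ⟩
      k !
    ∎ where open ≤-Reasoning

module UpperBound (M : ℕ) where

  open import Data.Nat
  open import Data.Nat.Properties
  open import Data.Nat.Combinatorics using (_C_) renaming (nCk+nC[k+1]≡[n+1]C[k+1] to pascal)
  open import Data.Bool using (true; false; if_then_else_)
  open import Data.Empty using (⊥-elim)
  open import Data.Product using (_×_; _,_; proj₂)
  open import Relation.Binary.PropositionalEquality
  open import Relation.Binary.Definitions using (tri<; tri≈; tri>)
  open import Relation.Nullary using (yes; no)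
  open RangeSum
  open YoungLattice M
  open DownUp M

  dropFirstRow : Shape → Shape
  dropFirstRow κ x = κ (suc x)

  dropFirstColumn : Shape → Shape
  dropFirstColumn κ x = pred (κ x)

  size : Shape → ℕ
  size κ = ∑ κ N

  HasLength : Shape → ℕ → Set
  HasLength κ ℓ = (κ ℓ ≡ 0) × (∀ x → x < ℓ → 1 ≤ κ x)

  pred≤removeCell : ∀ ν j x → pred (ν x) ≤ removeCell ν j x
  pred≤removeCell ν j x with x ≟ j
  ... | yes refl = ≤-reflexive (sym (removeCell-at ν x))
  ... | no ne    = subst (pred (ν x) ≤_) (sym (removeCell-off ν j x ne)) pred[n]≤n

  𝟙≤1 : ∀ b → 𝟙 b ≤ 1
  𝟙≤1 true  = ≤-refl
  𝟙≤1 false = z≤n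

  Decreasing-zero : ∀ κ → Decreasing κ → κ 0 ≡ 0 → ∀ x → κ x ≡ 0
  Decreasing-zero κ P e x = n≤0⇒n≡0 (subst (κ x ≤_) e (Decreasing-antitone κ P z≤n))

  f-0-empty : ∀ κ → (∀ x → κ x ≡ 0) → f 0 κ ≡ 1
  f-0-empty κ h = cong 𝟙 (agree⇒sameᵇ κ ∅ (λ x _ → h x))

  f-wide≡0 : ∀ n ν → n < ν 0 → f n ν ≡ 0
  f-wide≡0 zero    ν h = cong 𝟙 (sameᵇ-false ν ∅ 0 z<s (λ e → <⇒≢ h (sym e)))
  f-wide≡0 (suc n) ν h = ∑-≡0 N (λ j _ → trans (cong (when (removable ν j)) (f-wide≡0 n (removeCell ν j)
    (<-≤-trans (1+m<n⇒m<pred-n h) (pred≤removeCell ν j 0)))) (when-0 _))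

  f-tall≡0 : ∀ n ν → Decreasing ν → 1 ≤ ν n → f n ν ≡ 0
  f-tall≡0 zero    ν P h = cong 𝟙 (sameᵇ-false ν ∅ 0 z<s (λ e → <⇒≢ h (sym e)))
  f-tall≡0 (suc n) ν P h = ∑-≡0 N term
    where
    term : ∀ j → j < N → cornerTerm n ν j ≡ 0
    term j _ with removable ν j in r
    ... | false = refl
    ... | true  = f-tall≡0 n (removeCell ν j) (Decreasing-removeCell ν j P r) pos
      where
      pos : 1 ≤ removeCell ν j n
      pos with n ≟ j
      ... | yes refl = subst (1 ≤_) (sym (removeCell-at ν n)) (1+m<n⇒m<pred-n (≤-trans (s≤s h) (<ᵇ≡true⇒< (ν (suc n)) (ν n) r)))
      ... | no ne    = subst (1 ≤_) (sym (removeCell-off ν j n ne)) (≤-trans h (P n))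

  +pred : ∀ {a b n} → a + b ≡ suc n → 1 ≤ b → a + pred b ≡ n
  +pred {a} {suc b} e _ = suc-injective (trans (sym (+-suc a b)) e)

  pascal-* : ∀ n a c → (n C a) * c + (n C suc a) * c ≡ (suc n C suc a) * c
  pascal-* n a c = trans (sym (*-distribʳ-+ c (n C a) (n C suc a))) (cong (_* c) (pascal n a))

  -- The last corner removed lies either in the first row (a is unchanged) or in a
  -- lower row (a decreases); Pascal's rule adds up the two bounds.
  f≤C*f-dropFirstRow : ∀ n a κ → Decreasing κ → a + κ 0 ≡ n → f n κ ≤ (n C a) * f a (dropFirstRow κ)
  f≤C*f-dropFirstRow zero zero κ P e = ≤-trans (𝟙≤1 _)
    (≤-reflexive (sym (trans (+-identityʳ _) (f-0-empty (dropFirstRow κ) (λ x → Decreasing-zero κ P e (suc x))))))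
  f≤C*f-dropFirstRow (suc n) a κ P e = begin
      f (suc n) κ
    ≤⟨ +-mono-≤ topRow (lowerRows a e) ⟩
      (n C a) * f a μ + lowerBound a
    ≡⟨ total a ⟩
      (suc n C a) * f a μ
    ∎
    where
    open ≤-Reasoning
    μ = dropFirstRow κ
    topRow : cornerTerm n κ 0 ≤ (n C a) * f a μ
    topRow with removable κ 0 in r
    ... | false = z≤n
    ... | true  = ≤-trans (f≤C*f-dropFirstRow n a (removeCell κ 0) (Decreasing-removeCell κ 0 P r) (+pred e (removable⇒pos κ 0 r)))
                          (≤-reflexive (cong ((n C a) *_) (f-cong a _ _ (λ x → removeCell-off κ 0 (suc x) 1+n≢0))))
    lowerBound : ℕ → ℕ
    lowerBound zero    = 0
    lowerBound (suc a) = (n C a) * f (suc a) μ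
    lowerRows : ∀ a → a + κ 0 ≡ suc n → ∑[ j < M ] cornerTerm n κ (suc j) ≤ lowerBound a
    lowerRows zero e′ = ≤-reflexive (∑-≡0 M (λ j _ → trans (cong (when _) (f-wide≡0 n (removeCell κ (suc j))
      (subst (n <_) (trans (sym e′) (sym (removeCell-off κ (suc j) 0 0≢1+n))) (n<1+n n)))) (when-0 _)))
    lowerRows (suc a) e′ = begin
        ∑[ j < M ] cornerTerm n κ (suc j)
      ≤⟨ ∑-mono-≤ M (λ j _ → lowerRow j) ⟩
        ∑[ j < M ] ((n C a) * cornerTerm a μ j)
      ≡⟨ sym (∑-*ˡ M (n C a) (cornerTerm a μ)) ⟩
        (n C a) * ∑[ j < M ] cornerTerm a μ j
      ≤⟨ *-monoʳ-≤ (n C a) (≤-trans (m≤m+n _ _) (≤-reflexive (sym (∑-suc M (cornerTerm a μ))))) ⟩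
        (n C a) * f (suc a) μ
      ∎
      where
      lowerRow : ∀ j → cornerTerm n κ (suc j) ≤ (n C a) * cornerTerm a μ j
      lowerRow j with removable κ (suc j) in r
      ... | false = z≤n
      ... | true  = f≤C*f-dropFirstRow n a (removeCell κ (suc j)) (Decreasing-removeCell κ (suc j) P r) (suc-injective e′)
    total : ∀ a → (n C a) * f a μ + lowerBound a ≡ (suc n C a) * f a μ
    total zero    = +-identityʳ _
    total (suc a) = trans (+-comm _ ((n C a) * f (suc a) μ)) (pascal-* n a (f (suc a) μ))

  removeCell-empty : ∀ ν j x → ν j ≡ 0 → removeCell ν j x ≡ ν x
  removeCell-empty ν j x e with x ≟ j
  ... | yes refl = trans (removeCell-at ν x) (trans (cong pred e) (sym e))
  ... | no ne    = removeCell-off ν j x ne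

  dropFirstColumn-removeCell : ∀ κ j x → dropFirstColumn (removeCell κ j) x ≡ removeCell (dropFirstColumn κ) j x
  dropFirstColumn-removeCell κ j x with x ≟ j
  ... | yes refl = trans (cong pred (removeCell-at κ x)) (sym (removeCell-at (dropFirstColumn κ) x))
  ... | no ne    = trans (cong pred (removeCell-off κ j x ne)) (sym (removeCell-off (dropFirstColumn κ) j x ne))

  removable-dropFirstColumn : ∀ κ j → removable κ j ≡ true → 2 ≤ κ j → removable (dropFirstColumn κ) j ≡ true
  removable-dropFirstColumn κ j r two = <⇒<ᵇ≡true (pred-mono-<₂ (<ᵇ≡true⇒< _ _ r) two)
    where
    pred-mono-<₂ : ∀ {x y} → x < y → 2 ≤ y → pred x < pred y
    pred-mono-<₂ {zero}  {suc (suc y)} _       _ = s≤s z≤n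
    pred-mono-<₂ {zero}  {suc zero}    _       (s≤s ())
    pred-mono-<₂ {suc x} {suc y}       (s≤s h) _ = h

  HasLength-removeCell : ∀ κ ℓ j → HasLength κ ℓ → 2 ≤ κ j → HasLength (removeCell κ j) ℓ
  HasLength-removeCell κ ℓ j (L0 , L1) two = trans (removeCell-off κ j ℓ ℓ≢j) L0 , pos
    where
    ℓ≢j : ℓ ≢ j
    ℓ≢j refl = <⇒≢ (≤-trans (s≤s z≤n) two) (sym L0)
    pos : ∀ x → x < ℓ → 1 ≤ removeCell κ j x
    pos x x<ℓ with x ≟ j
    ... | yes refl = subst (1 ≤_) (sym (removeCell-at κ x)) (1+m<n⇒m<pred-n two)
    ... | no ne    = subst (1 ≤_) (sym (removeCell-off κ j x ne)) (L1 x x<ℓ)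

  single-cell-corner-is-last : ∀ κ ℓ j → Decreasing κ → HasLength κ ℓ → removable κ j ≡ true → κ j ≡ 1 → ℓ ≡ suc j
  single-cell-corner-is-last κ ℓ j P (L0 , L1) r one with <-cmp ℓ (suc j)
  ... | tri≈ _ ℓ≡1+j _ = ℓ≡1+j
  ... | tri< ℓ<1+j _ _ = ⊥-elim (1+n≢0 (trans (sym one) (n≤0⇒n≡0 (subst (κ j ≤_) L0 (Decreasing-antitone κ P (≤-pred ℓ<1+j))))))
  ... | tri> _ _ ℓ>1+j = ⊥-elim (<⇒≢ (L1 (suc j) ℓ>1+j) (sym below))
    where
    below : κ (suc j) ≡ 0
    below = n≤0⇒n≡0 (≤-pred (subst (κ (suc j) <_) one (<ᵇ≡true⇒< _ _ r)))

  HasLength-removeSingle : ∀ κ j → HasLength κ (suc j) → κ j ≡ 1 → HasLength (removeCell κ j) j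
  HasLength-removeSingle κ j (_ , L1) one =
    trans (removeCell-at κ j) (cong pred one) ,
    λ x x<j → subst (1 ≤_) (sym (removeCell-off κ j x (<⇒≢ x<j))) (L1 x (m<n⇒m<1+n x<j))

  ColumnBound : ℕ → Set
  ColumnBound n = ∀ a κ ℓ → Decreasing κ → HasLength κ ℓ → a + ℓ ≡ n → f n κ ≤ (n C a) * f a (dropFirstColumn κ)

  -- A corner in a row of length at least 2 keeps the column length and lowers a.
  longRowCorner : ∀ n a κ ℓ j → ColumnBound n → Decreasing κ → HasLength κ ℓ → suc a + ℓ ≡ suc n →
    removable κ j ≡ true → 2 ≤ κ j →
    f n (removeCell κ j) ≤ (n C a) * cornerTerm a (dropFirstColumn κ) j
  longRowCorner n a κ ℓ j bound P L e r two = ≤-trans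
    (bound a (removeCell κ j) ℓ (Decreasing-removeCell κ j P r) (HasLength-removeCell κ ℓ j L two) (suc-injective e))
    (≤-reflexive (cong ((n C a) *_) (trans (f-cong a _ _ (dropFirstColumn-removeCell κ j))
                                           (sym (when-true _ (removable-dropFirstColumn κ j r two))))))

  -- The cell of a last row of length 1 shortens the column and keeps a.
  lastRowCorner : ∀ n a κ ℓ j → ColumnBound n → Decreasing κ → HasLength κ ℓ → a + ℓ ≡ suc n →
    removable κ j ≡ true → κ j ≡ 1 → f n (removeCell κ j) ≤ (n C a) * f a (dropFirstColumn κ)
  lastRowCorner n a κ ℓ j bound P L e r one with single-cell-corner-is-last κ ℓ j P L r one
  ... | refl = ≤-trans
    (bound a (removeCell κ j) j (Decreasing-removeCell κ j P r) (HasLength-removeSingle κ j L one)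
           (suc-injective (trans (sym (+-suc a j)) e)))
    (≤-reflexive (cong ((n C a) *_) (f-cong a _ _ (λ x → trans (dropFirstColumn-removeCell κ j x)
                                                               (removeCell-empty (dropFirstColumn κ) j x (cong pred one))))))

  longCornerBound : ℕ → ℕ → Shape → ℕ → ℕ
  longCornerBound n zero    μ j = 0
  longCornerBound n (suc a) μ j = (n C a) * cornerTerm a μ j

  lastCornerBound : ℕ → ℕ → Shape → ℕ → ℕ → ℕ
  lastCornerBound n a μ ℓ j = if j ≡ᵇ pred ℓ then (n C a) * f a μ else 0

  pascal-cornerBounds : ∀ n a μ → ∑ (longCornerBound n a μ) N + (n C a) * f a μ ≡ (suc n C a) * f a μ
  pascal-cornerBounds n zero    μ = cong (_+ (n C 0) * f 0 μ) (∑-zero N)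
  pascal-cornerBounds n (suc a) μ =
    trans (cong (_+ (n C suc a) * f (suc a) μ) (sym (∑-*ˡ N (n C a) (cornerTerm a μ)))) (pascal-* n a (f (suc a) μ))

  cornerBound-column : ∀ n a κ ℓ j → ColumnBound n → Decreasing κ → HasLength κ ℓ → a + ℓ ≡ suc n →
    cornerTerm n κ j ≤ longCornerBound n a (dropFirstColumn κ) j + lastCornerBound n a (dropFirstColumn κ) ℓ j
  cornerBound-column n a κ ℓ j bound P L e with removable κ j in r | 2 ≤? κ j
  ... | false | _       = z≤n
  ... | true  | yes two = ≤-trans (longCorner a e) (m≤m+n _ _)
    where
    longCorner : ∀ a → a + ℓ ≡ suc n → f n (removeCell κ j) ≤ longCornerBound n a (dropFirstColumn κ) j
    longCorner zero    e = ≤-reflexive (f-tall≡0 n (removeCell κ j) (Decreasing-removeCell κ j P r)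
                               (proj₂ (HasLength-removeCell κ ℓ j L two) n (subst (n <_) (sym e) (n<1+n n))))
    longCorner (suc a) e = longRowCorner n a κ ℓ j bound P L e r two
  ... | true  | no ¬two = ≤-trans (≤-trans (lastRowCorner n a κ ℓ j bound P L e r one) (≤-reflexive (sym lastCorner)))
                                  (m≤n+m _ _)
    where
    one : κ j ≡ 1
    one = ≤-antisym (≤-pred (≰⇒> ¬two)) (removable⇒pos κ j r)
    lastCorner : lastCornerBound n a (dropFirstColumn κ) ℓ j ≡ (n C a) * f a (dropFirstColumn κ)
    lastCorner = trans (cong (λ z → if j ≡ᵇ pred z then (n C a) * f a (dropFirstColumn κ) else 0)
                             (single-cell-corner-is-last κ ℓ j P L r one))
                       (if-≡ j _ _)

  f≤C*f-dropFirstColumn : ∀ n → ColumnBound n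
  f≤C*f-dropFirstColumn zero zero κ zero P (L0 , _) e = ≤-trans (𝟙≤1 _)
    (≤-reflexive (sym (trans (+-identityʳ _) (f-0-empty (dropFirstColumn κ) (λ x → cong pred (Decreasing-zero κ P L0 x))))))
  f≤C*f-dropFirstColumn (suc n) a κ ℓ P L e = begin
      f (suc n) κ
    ≤⟨ ∑-mono-≤ N (λ j _ → cornerBound-column n a κ ℓ j (f≤C*f-dropFirstColumn n) P L e) ⟩
      ∑[ j < N ] (longCornerBound n a μ j + lastCornerBound n a μ ℓ j)
    ≡⟨ ∑-+ N (longCornerBound n a μ) (lastCornerBound n a μ ℓ) ⟩
      ∑ (longCornerBound n a μ) N + ∑ (lastCornerBound n a μ ℓ) N
    ≤⟨ +-monoʳ-≤ (∑ (longCornerBound n a μ) N) (∑-singleton≤ N (pred ℓ) ((n C a) * f a μ)) ⟩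
      ∑ (longCornerBound n a μ) N + (n C a) * f a μ
    ≡⟨ pascal-cornerBounds n a μ ⟩
      (suc n C a) * f a μ
    ∎
    where
    open ≤-Reasoning
    μ = dropFirstColumn κ

module LowerBound (M : ℕ) where

  open import Data.Nat
  open import Data.Nat.Properties
  open import Data.Nat.Combinatorics using (_C_; k>n⇒nCk≡0; nCn≡1; nC1≡n; nCk≡nC[n∸k])
    renaming (nCk+nC[k+1]≡[n+1]C[k+1] to pascal)
  open import Data.Bool using (true; false; if_then_else_)
  open import Data.Empty using (⊥-elim)
  open import Data.Product using (_×_; _,_; proj₂; Σ-syntax)
  open import Relation.Binary.PropositionalEquality
  open import Relation.Nullary using (yes; no)
  open RangeSum
  open YoungLattice M
  open DownUp M
  open UpperBound M

  findCorner : ∀ c ν p → VanishesFrom M ν → 1 ≤ c → c ≤ ν p → Σ[ j ∈ ℕ ] (p ≤ j × j < M × c ≤ ν j × ν (suc j) < c)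
  findCorner c ν p V 1≤c c≤νp with M <? p
  ... | yes M<p  = ⊥-elim (<⇒≢ (≤-trans 1≤c c≤νp) (sym (V p (<⇒≤ M<p))))
  ... | no ¬M<p = go (M ∸ p) p (m+[n∸m]≡n (≮⇒≥ ¬M<p)) c≤νp
    where
    go : ∀ d p → p + d ≡ M → c ≤ ν p → Σ[ j ∈ ℕ ] (p ≤ j × j < M × c ≤ ν j × ν (suc j) < c)
    go zero    p e c≤νp = ⊥-elim (<⇒≢ (≤-trans 1≤c c≤νp) (sym (V p (≤-reflexive (trans (sym e) (+-identityʳ p))))))
    go (suc d) p e c≤νp with ν (suc p) <? c
    ... | yes lt = p , ≤-refl , subst (p <_) e (m<m+n p z<s) , c≤νp , lt
    ... | no ¬lt with go d (suc p) (trans (sym (+-suc p d)) e) (≮⇒≥ ¬lt)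
    ...   | j , p<j , rest = j , ≤-trans (n≤1+n p) p<j , rest

  size-removeCell : ∀ κ j → j < N → 1 ≤ κ j → suc (size (removeCell κ j)) ≡ size κ
  size-removeCell κ j j<N pos = begin
      suc (size (removeCell κ j))
    ≡⟨ cong suc (∑-pick N (removeCell κ j) j j<N) ⟩
      suc (removeCell κ j j + ∑[ x < N ] (if x ≡ᵇ j then 0 else removeCell κ j x))
    ≡⟨ cong (λ z → suc (z + ∑[ x < N ] (if x ≡ᵇ j then 0 else removeCell κ j x))) (removeCell-at κ j) ⟩
      suc (pred (κ j) + ∑[ x < N ] (if x ≡ᵇ j then 0 else removeCell κ j x))
    ≡⟨ cong₂ _+_ (suc-pred (κ j) {{>-nonZero pos}}) (∑-cong N rest) ⟩
      κ j + ∑[ x < N ] (if x ≡ᵇ j then 0 else κ x)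
    ≡⟨ sym (∑-pick N κ j j<N) ⟩
      size κ
    ∎
    where
    open ≡-Reasoning
    rest : ∀ x → x < N → (if x ≡ᵇ j then 0 else removeCell κ j x) ≡ (if x ≡ᵇ j then 0 else κ x)
    rest x _ with x ≟ j
    ... | yes refl = trans (if-≡ x 0 _) (sym (if-≡ x 0 _))
    ... | no ne    = trans (if-≢ x j 0 _ ne) (trans (removeCell-off κ j x ne) (sym (if-≢ x j 0 _ ne)))

  size-removeCorner : ∀ n κ j → j < N → removable κ j ≡ true → size κ ≡ suc n → size (removeCell κ j) ≡ n
  size-removeCorner n κ j j<N r s = suc-injective (trans (size-removeCell κ j j<N (removable⇒pos κ j r)) s)

  size-zero : ∀ κ → Decreasing κ → κ 0 ≡ 0 → size κ ≡ 0
  size-zero κ P e = ∑-≡0 N (λ x _ → Decreasing-zero κ P e x)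

  first-row-pos : ∀ n κ → Decreasing κ → size κ ≡ suc n → 1 ≤ κ 0
  first-row-pos n κ P s = n≢0⇒n>0 (λ e → 0≢1+n (trans (sym (size-zero κ P e)) s))

  size≤length*width : ∀ κ ℓ → Decreasing κ → HasLength κ ℓ → ℓ ≤ N → size κ ≤ ℓ * κ 0
  size≤length*width κ ℓ P (L0 , L1) le = begin
      size κ
    ≤⟨ ∑-mono-≤ N (λ x _ → b x) ⟩
      ∑[ x < N ] when (x <ᵇ ℓ) (κ 0)
    ≡⟨ ∑-when-const N (λ x → x <ᵇ ℓ) (κ 0) ⟩
      (∑[ x < N ] 𝟙 (x <ᵇ ℓ)) * κ 0
    ≡⟨ cong (_* κ 0) (∑-𝟙-< N ℓ le) ⟩
      ℓ * κ 0
    ∎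
    where
    open ≤-Reasoning
    b : ∀ x → κ x ≤ when (x <ᵇ ℓ) (κ 0)
    b x with x <? ℓ
    ... | yes lt = subst (κ x ≤_) (sym (when-true _ (<⇒<ᵇ≡true lt))) (Decreasing-antitone κ P z≤n)
    ... | no nlt = subst (κ x ≤_) (sym (when-false _ (≥⇒<ᵇ≡false (≮⇒≥ nlt)))) (subst (κ x ≤_) L0 (Decreasing-antitone κ P (≮⇒≥ nlt)))

  length*c≤size : ∀ κ ℓ c → ℓ ≤ N → (∀ x → x < ℓ → c ≤ κ x) → ℓ * c ≤ size κ
  length*c≤size κ ℓ c le h = begin
      ℓ * c
    ≡⟨ cong (_* c) (sym (∑-𝟙-< N ℓ le)) ⟩
      (∑[ x < N ] 𝟙 (x <ᵇ ℓ)) * c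
    ≡⟨ sym (∑-when-const N (λ x → x <ᵇ ℓ) c) ⟩
      ∑[ x < N ] when (x <ᵇ ℓ) c
    ≤⟨ ∑-mono-≤ N (λ x _ → b x) ⟩
      size κ
    ∎
    where
    open ≤-Reasoning
    b : ∀ x → when (x <ᵇ ℓ) c ≤ κ x
    b x with x <? ℓ
    ... | yes lt = subst (_≤ κ x) (sym (when-true _ (<⇒<ᵇ≡true lt))) (h x lt)
    ... | no nlt = subst (_≤ κ x) (sym (when-false _ (≥⇒<ᵇ≡false (≮⇒≥ nlt)))) z≤n

  length≤M : ∀ κ ℓ → VanishesFrom M κ → HasLength κ ℓ → ℓ ≤ M
  length≤M κ ℓ V (L0 , L1) with M <? ℓ
  ... | yes lt = ⊥-elim (<⇒≢ (L1 M lt) (sym (V M ≤-refl)))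
  ... | no nlt = ≮⇒≥ nlt

  C-monoˡ : ∀ m a → m C a ≤ suc m C a
  C-monoˡ m zero    = ≤-refl
  C-monoˡ m (suc a) = subst (m C suc a ≤_) (pascal m a) (m≤n+m _ _)

  C-suc≤C : ∀ m a → 1 ≤ m → m ≤ suc a → m C (suc a) ≤ m C a
  C-suc≤C m a _ m≤1+a with m <? suc a
  ... | yes m<1+a = subst (_≤ m C a) (sym (k>n⇒nCk≡0 m<1+a)) z≤n
  ... | no ¬m<1+a with ≤-antisym m≤1+a (≮⇒≥ ¬m<1+a)
  ... | refl = subst₂ _≤_ (sym (nCn≡1 (suc a)))
                 (sym (trans (nCk≡nC[n∸k] (n≤1+n a)) (trans (cong (suc a C_) (m+n∸n≡m 1 a)) (nC1≡n (suc a)))))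
                 (s≤s z≤n)

  pascal-pred : ∀ m a → 1 ≤ m → pred m C a + pred m C suc a ≡ m C suc a
  pascal-pred m a 1≤m = trans (pascal (pred m) a) (cong (_C suc a) (suc-pred m {{>-nonZero 1≤m}}))

  ≤when-removable : ∀ {c} n κ j → removable κ j ≡ true → c ≤ f n (removeCell κ j) →
                    c ≤ cornerTerm n κ j
  ≤when-removable n κ j r h = subst (_ ≤_) (sym (when-true _ r)) h

  lower-rows-nonempty : ∀ n a κ → Decreasing κ → size κ ≡ suc n → suc a + κ 0 ≡ suc n → 1 ≤ κ 1
  lower-rows-nonempty n a κ P s e = n≢0⇒n>0 λ κ1≡0 → <⇒≢ (m<n+m (κ 0) {suc a} z<s) (sym (begin
      suc a + κ 0                ≡⟨ trans e (sym s) ⟩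
      κ 0 + ∑[ x < M ] κ (suc x) ≡⟨ cong (κ 0 +_) (∑-≡0 M (λ x _ → n≤0⇒n≡0
                                      (subst (κ (suc x) ≤_) κ1≡0 (Decreasing-antitone κ P (s≤s z≤n))))) ⟩
      κ 0 + 0                    ≡⟨ +-identityʳ (κ 0) ⟩
      κ 0                        ∎))
    where open ≡-Reasoning

  RowLowerBound : ℕ → Set
  RowLowerBound n = ∀ a κ → Decreasing κ → VanishesFrom M κ → size κ ≡ n → a + κ 0 ≡ n → (κ 0) C a ≤ f n κ

  topCorner-row : ∀ n a κ → RowLowerBound n → Decreasing κ → VanishesFrom M κ → size κ ≡ suc n → a + κ 0 ≡ suc n →
    removable κ 0 ≡ true → pred (κ 0) C a ≤ cornerTerm n κ 0
  topCorner-row n a κ bound P V s e r = ≤when-removable n κ 0 r (subst (λ w → w C a ≤ f n (removeCell κ 0)) (removeCell-at κ 0)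
    (bound a (removeCell κ 0) (Decreasing-removeCell κ 0 P r) (Vanishes-removeCell M κ 0 V) (size-removeCorner n κ 0 z<s r s)
           (trans (cong (a +_) (removeCell-at κ 0)) (+pred e (removable⇒pos κ 0 r)))))

  -- Some lower row has a corner; removing it keeps the first row and lowers a.
  lowerCorner-row : ∀ n a κ → RowLowerBound n → Decreasing κ → VanishesFrom M κ → size κ ≡ suc n → suc a + κ 0 ≡ suc n →
    1 ≤ κ 1 → Σ[ j ∈ ℕ ] (1 ≤ j × j < M × (κ 0) C a ≤ cornerTerm n κ j)
  lowerCorner-row n a κ bound P V s e 1≤κ1 with findCorner 1 κ 1 V ≤-refl 1≤κ1
  ... | j , 1≤j , j<M , 1≤κj , κ[1+j]<1 = j , 1≤j , j<M , ≤when-removable n κ j r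
    (subst (λ w → w C a ≤ f n (removeCell κ j)) top
      (bound a (removeCell κ j) (Decreasing-removeCell κ j P r) (Vanishes-removeCell M κ j V)
             (size-removeCorner n κ j (m<n⇒m<1+n j<M) r s) (suc-injective (trans (cong (suc a +_) top) e))))
    where
    r : removable κ j ≡ true
    r = <⇒<ᵇ≡true (<-≤-trans κ[1+j]<1 1≤κj)
    top : removeCell κ j 0 ≡ κ 0
    top = removeCell-off κ j 0 (<⇒≢ 1≤j)

  width≤a : ∀ n a κ → Decreasing κ → 1 ≤ M → size κ ≡ n → a + κ 0 ≡ n → removable κ 0 ≡ false → κ 1 ≡ κ 0 × κ 0 ≤ a
  width≤a n a κ P 1≤M s e r = κ1≡κ0 , +-cancelʳ-≤ (κ 0) (κ 0) a (begin
      κ 0 + κ 0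
    ≡⟨ cong (κ 0 +_) (sym κ1≡κ0) ⟩
      κ 0 + κ 1
    ≤⟨ +-monoʳ-≤ (κ 0) (term≤∑ M (λ x → κ (suc x)) 0 1≤M) ⟩
      size κ
    ≡⟨ trans s (sym e) ⟩
      a + κ 0
    ∎)
    where
    open ≤-Reasoning
    κ1≡κ0 : κ 1 ≡ κ 0
    κ1≡κ0 = ≤-antisym (P 0) (<ᵇ≡false⇒≥ _ _ r)

  C≤f-firstRow : ∀ n → 1 ≤ M → RowLowerBound n
  C≤f-firstRow zero    _   zero κ P V s e = ≤-reflexive (sym (f-0-empty κ (Decreasing-zero κ P e)))
  C≤f-firstRow (suc n) 1≤M a κ P V s e with κ 1 <? κ 0 | a
  ... | yes κ1<κ0 | zero   = ≤-trans (topCorner-row n 0 κ (C≤f-firstRow n 1≤M) P V s e (<⇒<ᵇ≡true κ1<κ0)) (term≤∑ N (cornerTerm n κ) 0 z<s)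
  ... | yes κ1<κ0 | suc a′ with lowerCorner-row n a′ κ (C≤f-firstRow n 1≤M) P V s e (lower-rows-nonempty n a′ κ P s e)
  ...   | j , 1≤j , j<M , lower = begin
      κ 0 C suc a′
    ≡⟨ sym (pascal-pred (κ 0) a′ (first-row-pos n κ P s)) ⟩
      pred (κ 0) C a′ + pred (κ 0) C suc a′
    ≤⟨ +-mono-≤ (≤-trans (C-monoˡ (pred (κ 0)) a′) (≤-reflexive (cong (_C a′) (suc-pred (κ 0) {{>-nonZero (first-row-pos n κ P s)}}))))
                (topCorner-row n (suc a′) κ (C≤f-firstRow n 1≤M) P V s e (<⇒<ᵇ≡true κ1<κ0)) ⟩
      κ 0 C a′ + cornerTerm n κ 0
    ≤⟨ +-monoˡ-≤ (cornerTerm n κ 0) lower ⟩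
      cornerTerm n κ j + cornerTerm n κ 0
    ≤⟨ two-terms≤∑ N (cornerTerm n κ) j 0 (m<n⇒m<1+n j<M) z<s (λ j≡0 → <⇒≢ 1≤j (sym j≡0)) ⟩
      f (suc n) κ
    ∎ where open ≤-Reasoning
  C≤f-firstRow (suc n) 1≤M a κ P V s e | no κ1≮κ0 | zero =
    ⊥-elim (<⇒≢ (≤-trans (first-row-pos n κ P s) (proj₂ (width≤a (suc n) zero κ P 1≤M s e (≥⇒<ᵇ≡false (≮⇒≥ κ1≮κ0))))) refl)
  C≤f-firstRow (suc n) 1≤M a κ P V s e | no κ1≮κ0 | suc a′ with width≤a (suc n) (suc a′) κ P 1≤M s e (≥⇒<ᵇ≡false (≮⇒≥ κ1≮κ0))
  ...   | κ1≡κ0 , κ0≤a with lowerCorner-row n a′ κ (C≤f-firstRow n 1≤M) P V s e (subst (1 ≤_) (sym κ1≡κ0) (first-row-pos n κ P s))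
  ...     | j , _ , j<M , lower =
    ≤-trans (C-suc≤C (κ 0) a′ (first-row-pos n κ P s) κ0≤a) (≤-trans lower (term≤∑ N (cornerTerm n κ) j (m<n⇒m<1+n j<M)))

  ColumnLowerBound : ℕ → Set
  ColumnLowerBound n = ∀ a κ ℓ → Decreasing κ → VanishesFrom M κ → HasLength κ ℓ → size κ ≡ n → a + ℓ ≡ n → ℓ C a ≤ f n κ

  lastRow-removable : ∀ κ ℓ → HasLength κ (suc ℓ) → removable κ ℓ ≡ true
  lastRow-removable κ ℓ (L0 , L1) = <⇒<ᵇ≡true (subst (_< κ ℓ) (sym L0) (L1 ℓ ≤-refl))

  wide-when-a-pos : ∀ n a κ ℓ → Decreasing κ → VanishesFrom M κ → HasLength κ ℓ → size κ ≡ n → suc a + ℓ ≡ n → 2 ≤ κ 0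
  wide-when-a-pos n a κ ℓ P V L s e with 2 ≤? κ 0
  ... | yes two = two
  ... | no ¬two = ⊥-elim (<⇒≱ (m<n+m ℓ {suc a} z<s) (begin
      suc a + ℓ ≡⟨ trans e (sym s) ⟩
      size κ    ≤⟨ size≤length*width κ ℓ P L (m≤n⇒m≤1+n (length≤M κ ℓ V L)) ⟩
      ℓ * κ 0   ≤⟨ *-monoʳ-≤ ℓ (≤-pred (≰⇒> ¬two)) ⟩
      ℓ * 1     ≡⟨ *-identityʳ ℓ ⟩
      ℓ         ∎))
    where open ≤-Reasoning

  -- If the last row has at least 2 cells, so do all rows, and then a ≥ ℓ.
  length≤a : ∀ n a κ ℓ → Decreasing κ → VanishesFrom M κ → HasLength κ (suc ℓ) → size κ ≡ n → a + suc ℓ ≡ n →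
    2 ≤ κ ℓ → suc ℓ ≤ a
  length≤a n a κ ℓ P V L s e two = +-cancelʳ-≤ (suc ℓ) (suc ℓ) a (begin
      suc ℓ + suc ℓ ≡⟨ cong (suc ℓ +_) (sym (+-identityʳ (suc ℓ))) ⟩
      2 * suc ℓ     ≡⟨ *-comm 2 (suc ℓ) ⟩
      suc ℓ * 2     ≤⟨ length*c≤size κ (suc ℓ) 2 (m≤n⇒m≤1+n (length≤M κ (suc ℓ) V L))
                         (λ x x<1+ℓ → ≤-trans two (Decreasing-antitone κ P (≤-pred x<1+ℓ))) ⟩
      size κ        ≡⟨ trans s (sym e) ⟩
      a + suc ℓ     ∎)
    where open ≤-Reasoning

  longRowCorner-column : ∀ n a κ ℓ j → ColumnLowerBound n → Decreasing κ → VanishesFrom M κ → HasLength κ ℓ →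
    size κ ≡ suc n → suc a + ℓ ≡ suc n → j < N → removable κ j ≡ true → 2 ≤ κ j → ℓ C a ≤ cornerTerm n κ j
  longRowCorner-column n a κ ℓ j bound P V L s e j<N r two = ≤when-removable n κ j r
    (bound a (removeCell κ j) ℓ (Decreasing-removeCell κ j P r) (Vanishes-removeCell M κ j V)
           (HasLength-removeCell κ ℓ j L two) (size-removeCorner n κ j j<N r s) (suc-injective e))

  lastRowCorner-column : ∀ n a κ ℓ → ColumnLowerBound n → Decreasing κ → VanishesFrom M κ → HasLength κ (suc ℓ) →
    size κ ≡ suc n → a + suc ℓ ≡ suc n → ℓ < N → κ ℓ ≡ 1 → ℓ C a ≤ cornerTerm n κ ℓ
  lastRowCorner-column n a κ ℓ bound P V L s e ℓ<N one = ≤when-removable n κ ℓ r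
    (bound a (removeCell κ ℓ) ℓ (Decreasing-removeCell κ ℓ P r) (Vanishes-removeCell M κ ℓ V)
           (HasLength-removeSingle κ ℓ L one) (size-removeCorner n κ ℓ ℓ<N r s) (suc-injective (trans (sym (+-suc a ℓ)) e)))
    where
    r : removable κ ℓ ≡ true
    r = lastRow-removable κ ℓ L

  C≤f-firstColumn : ∀ n → ColumnLowerBound n
  C≤f-firstColumn zero    zero κ zero    P V (L0 , _) s e = ≤-reflexive (sym (f-0-empty κ (Decreasing-zero κ P L0)))
  C≤f-firstColumn (suc n) a    κ zero    P V (L0 , _) s e = ⊥-elim (0≢1+n (trans (sym (size-zero κ P L0)) s))
  C≤f-firstColumn (suc n) a    κ (suc ℓ) P V L s e with 2 ≤? κ ℓ | a
  ... | no ¬two | zero   = ≤-trans (lastRowCorner-column n 0 κ ℓ (C≤f-firstColumn n) P V L s e ℓ<N one) (term≤∑ N (cornerTerm n κ) ℓ ℓ<N)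
    where
    ℓ<N = m<n⇒m<1+n (length≤M κ (suc ℓ) V L)
    one = ≤-antisym (≤-pred (≰⇒> ¬two)) (proj₂ L ℓ ≤-refl)
  ... | no ¬two | suc a′ with findCorner 2 κ 0 V (s≤s z≤n) (wide-when-a-pos (suc n) a′ κ (suc ℓ) P V L s e)
  ...   | j , _ , j<M , 2≤κj , κ[1+j]<2 = begin
      suc ℓ C suc a′
    ≡⟨ sym (pascal ℓ a′) ⟩
      ℓ C a′ + ℓ C suc a′
    ≤⟨ +-mono-≤ (≤-trans (C-monoˡ ℓ a′) (longRowCorner-column n a′ κ (suc ℓ) j (C≤f-firstColumn n) P V L s e (m<n⇒m<1+n j<M) rj 2≤κj))
                (lastRowCorner-column n (suc a′) κ ℓ (C≤f-firstColumn n) P V L s e ℓ<N one) ⟩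
      cornerTerm n κ j + cornerTerm n κ ℓ
    ≤⟨ two-terms≤∑ N (cornerTerm n κ) j ℓ (m<n⇒m<1+n j<M) ℓ<N j≢ℓ ⟩
      f (suc n) κ
    ∎
    where
    open ≤-Reasoning
    ℓ<N = m<n⇒m<1+n (length≤M κ (suc ℓ) V L)
    one = ≤-antisym (≤-pred (≰⇒> ¬two)) (proj₂ L ℓ ≤-refl)
    rj = <⇒<ᵇ≡true (<-≤-trans κ[1+j]<2 2≤κj)
    j≢ℓ : j ≢ ℓ
    j≢ℓ refl = ¬two 2≤κj
  C≤f-firstColumn (suc n) a κ (suc ℓ) P V L s e | yes two | zero = ⊥-elim (<⇒≱ z<s (length≤a (suc n) zero κ ℓ P V L s e two))
  C≤f-firstColumn (suc n) a κ (suc ℓ) P V L s e | yes two | suc a′ =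
    ≤-trans (C-suc≤C (suc ℓ) a′ (s≤s z≤n) (length≤a (suc n) (suc a′) κ ℓ P V L s e two))
            (≤-trans (longRowCorner-column n a′ κ (suc ℓ) ℓ (C≤f-firstColumn n) P V L s e ℓ<N (lastRow-removable κ ℓ L) two)
                     (term≤∑ N (cornerTerm n κ) ℓ ℓ<N))
    where
    ℓ<N = m<n⇒m<1+n (length≤M κ (suc ℓ) V L)

module ListShape (M : ℕ) where

  open import Data.Nat
  open import Data.Nat.Properties
  open import Data.Nat.ListAction using (sum)
  open import Data.List using (List; []; _∷_; length)
  open import Data.List.Relation.Unary.All using (All; []; _∷_)
  open import Data.List.Relation.Unary.Linked using (Linked; []; [-]; _∷_)
  open import Data.Bool using (true)
  open import Data.Empty using (⊥-elim)
  open import Data.Product using (_,_)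
  open import Function using (_∘_)
  open import Relation.Binary.PropositionalEquality
  open import Relation.Nullary using (yes; no)
  open import Defs
  open RangeSum
  open YoungLattice M

  toShape : List ℕ → Shape
  toShape [] x = 0
  toShape (a ∷ as) zero = a
  toShape (a ∷ as) (suc x) = toShape as x

  toShape-head : ∀ λp → toShape λp 0 ≡ largestPart λp
  toShape-head []      = refl
  toShape-head (_ ∷ _) = refl

  consPos : ℕ → List ℕ → List ℕ
  consPos zero as = as
  consPos (suc b) as = suc b ∷ as

  removeAt : ℕ → List ℕ → List ℕ
  removeAt _ [] = []
  removeAt zero (a ∷ as) = consPos (pred a) as
  removeAt (suc j) (a ∷ as) = a ∷ removeAt j as

  addAt : ℕ → List ℕ → List ℕ
  addAt zero [] = 1 ∷ []
  addAt zero (a ∷ as) = suc a ∷ as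
  addAt (suc j) [] = []
  addAt (suc j) (a ∷ as) = a ∷ addAt j as

  Pos : List ℕ → Set
  Pos = All (λ x → 0 < x)

  toShape-pos : ∀ λp → Pos λp → ∀ x → x < length λp → 1 ≤ toShape λp x
  toShape-pos (a ∷ as) (pa ∷ _) zero _ = pa
  toShape-pos (a ∷ as) (_ ∷ ps) (suc x) (s<s lt) = toShape-pos as ps x lt

  toShape-vanishes : ∀ λp x → length λp ≤ x → toShape λp x ≡ 0
  toShape-vanishes [] x _ = refl
  toShape-vanishes (a ∷ as) (suc x) (s≤s le) = toShape-vanishes as x le

  toShape-decreasing : ∀ λp → Linked _≥_ λp → Decreasing (toShape λp)
  toShape-decreasing [] _ x = z≤n
  toShape-decreasing (a ∷ []) _ zero = z≤n
  toShape-decreasing (a ∷ []) _ (suc x) = z≤n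
  toShape-decreasing (a ∷ b ∷ rest) (ab ∷ l) zero = ab
  toShape-decreasing (a ∷ b ∷ rest) (ab ∷ l) (suc x) = toShape-decreasing (b ∷ rest) l x

  decreasing⇒Linked : ∀ λp → Decreasing (toShape λp) → Linked _≥_ λp
  decreasing⇒Linked [] P = []
  decreasing⇒Linked (a ∷ []) P = [-]
  decreasing⇒Linked (a ∷ b ∷ rest) P = P 0 ∷ decreasing⇒Linked (b ∷ rest) (P ∘ suc)

  length≤sum : ∀ λp → Pos λp → length λp ≤ sum λp
  length≤sum [] _ = z≤n
  length≤sum (a ∷ as) (pa ∷ ps) = +-mono-≤ pa (length≤sum as ps)

  ∑-toShape : ∀ λp K → length λp ≤ K → ∑ (toShape λp) K ≡ sum λp
  ∑-toShape [] K _ = ∑-zero K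
  ∑-toShape (a ∷ as) (suc K) (s≤s le) = cong (a +_) (∑-toShape as K le)

  removable⇒<length : ∀ λp j → removable (toShape λp) j ≡ true → j < length λp
  removable⇒<length λp j r with j <? length λp
  ... | yes lt = lt
  ... | no nlt = ⊥-elim (<⇒≢ (removable⇒pos (toShape λp) j r) (sym (toShape-vanishes λp j (≮⇒≥ nlt))))

  head≡0⇒[] : ∀ as → Pos as → toShape as 0 ≡ 0 → as ≡ []
  head≡0⇒[] [] _ _ = refl
  head≡0⇒[] (b ∷ bs) (pb ∷ _) e = ⊥-elim (<⇒≢ pb (sym e))

  toShape-removeAt : ∀ λp j → Pos λp → removable (toShape λp) j ≡ true → ∀ x → toShape (removeAt j λp) x ≡ removeCell (toShape λp) j x
  toShape-removeAt [] j _ r x = ⊥-elim (<⇒≢ (removable⇒pos (toShape []) j r) refl)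
  toShape-removeAt (suc zero ∷ as) zero (_ ∷ ps) r x rewrite head≡0⇒[] as ps (n≤0⇒n≡0 (≤-pred (<ᵇ≡true⇒< _ _ r))) with x
  ... | zero = refl
  ... | suc x' = refl
  toShape-removeAt (suc (suc b) ∷ as) zero _ r zero = refl
  toShape-removeAt (suc (suc b) ∷ as) zero _ r (suc x) = refl
  toShape-removeAt (zero ∷ as) zero (() ∷ _) r x
  toShape-removeAt (a ∷ as) (suc j) (_ ∷ ps) r zero = refl
  toShape-removeAt (a ∷ as) (suc j) (_ ∷ ps) r (suc x) = toShape-removeAt as j ps r x

  removeAt-pos : ∀ λp j → Pos λp → Pos (removeAt j λp)
  removeAt-pos [] j _ = []
  removeAt-pos (a ∷ as) zero (_ ∷ ps) = cp (pred a) ps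
    where
    cp : ∀ b → Pos as → Pos (consPos b as)
    cp zero    ps′ = ps′
    cp (suc b) ps′ = s≤s z≤n ∷ ps′
  removeAt-pos (a ∷ as) (suc j) (pa ∷ ps) = pa ∷ removeAt-pos as j ps

  sum-removeAt : ∀ λp j → Pos λp → j < length λp → suc (sum (removeAt j λp)) ≡ sum λp
  sum-removeAt (suc zero ∷ as) zero _ _ = refl
  sum-removeAt (suc (suc b) ∷ as) zero _ _ = refl
  sum-removeAt (zero ∷ as) zero (() ∷ _) _
  sum-removeAt (a ∷ as) (suc j) (_ ∷ ps) (s<s lt) = trans (sym (+-suc a _)) (cong (a +_) (sum-removeAt as j ps lt))

  addAt-removeAt : ∀ λp j → Pos λp → removable (toShape λp) j ≡ true → addAt j (removeAt j λp) ≡ λp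
  addAt-removeAt [] j _ r = ⊥-elim (<⇒≢ (removable⇒pos (toShape []) j r) refl)
  addAt-removeAt (suc zero ∷ as) zero (_ ∷ ps) r rewrite head≡0⇒[] as ps (n≤0⇒n≡0 (≤-pred (<ᵇ≡true⇒< _ _ r))) = refl
  addAt-removeAt (suc (suc b) ∷ as) zero _ r = refl
  addAt-removeAt (zero ∷ as) zero (() ∷ _) r
  addAt-removeAt (a ∷ as) (suc j) (_ ∷ ps) r = cong (a ∷_) (addAt-removeAt as j ps r)

  ≤length-removeAt : ∀ λp j → j < length λp → j ≤ length (removeAt j λp)
  ≤length-removeAt (a ∷ as) zero _ = z≤n
  ≤length-removeAt (a ∷ as) (suc j) (s<s lt) = s≤s (≤length-removeAt as j lt)

  IsPartition-removeAt : ∀ n λp j → IsPartition (suc n) λp → removable (toShape λp) j ≡ true → IsPartition n (removeAt j λp)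
  IsPartition-removeAt n λp j (lk , ps , sm) r =
    decreasing⇒Linked (removeAt j λp) (λ x → subst₂ _≤_ (sym (toShape-removeAt λp j ps r (suc x))) (sym (toShape-removeAt λp j ps r x))
       (Decreasing-removeCell (toShape λp) j (toShape-decreasing λp lk) r x)) ,
    removeAt-pos λp j ps ,
    suc-injective (trans (sum-removeAt λp j ps (removable⇒<length λp j r)) sm)

module Tableaux (M : ℕ) where

  open import Data.Nat
  open import Data.Nat.Properties
  open import Data.List using (List; []; _∷_; length; map; concat; upTo; _++_)
  open import Data.List.Properties using (++-assoc; length-++)
  open import Data.List.Relation.Unary.All using (All; []; _∷_)
  import Data.List.Relation.Unary.All as All
  open import Data.List.Relation.Unary.All.Properties using (concat⁻)
  open import Data.List.Relation.Unary.Any using (here; there)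
  open import Data.List.Relation.Unary.Linked using (Linked; []; [-]; _∷_)
  open import Data.List.Membership.Propositional using (_∈_)
  open import Data.List.Membership.Propositional.Properties using (∈-upTo⁻; ∈-++⁻; ∈-++⁺ʳ)
  open import Data.List.Membership.DecPropositional _≟_ using (_∈?_)
  open import Data.List.Relation.Binary.Permutation.Propositional using (_↭_; ↭-sym; ↭-trans; ↭-refl; ↭-reflexive)
  open import Data.List.Relation.Binary.Permutation.Propositional.Properties using (All-resp-↭; ++⁺ˡ; ++-comm)
  open import Data.Bool using (if_then_else_)
  open import Data.Empty using (⊥; ⊥-elim)
  open import Data.Unit using (⊤; tt)
  open import Data.Sum using (inj₁; inj₂)
  open import Data.Product using (_×_; _,_; proj₁; proj₂; ∃)
  open import Relation.Binary.PropositionalEquality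
  open import Relation.Nullary using (yes; no; does)
  open import Relation.Nullary.Decidable using (dec-true; dec-false)
  open import Defs
  open ListShape M

  Tableau : Set
  Tableau = List (List ℕ)

  rowAt : ℕ → Tableau → List ℕ
  rowAt _ [] = []
  rowAt zero (r ∷ _) = r
  rowAt (suc j) (_ ∷ rs) = rowAt j rs

  dropLast : List ℕ → List ℕ
  dropLast [] = []
  dropLast (x ∷ []) = []
  dropLast (x ∷ y ∷ ys) = x ∷ dropLast (y ∷ ys)

  consNonEmpty : List ℕ → Tableau → Tableau
  consNonEmpty [] rs = rs
  consNonEmpty (x ∷ xs) rs = (x ∷ xs) ∷ rs

  popRow : ℕ → Tableau → Tableau
  popRow _ [] = []
  popRow zero (r ∷ rs) = consNonEmpty (dropLast r) rs
  popRow (suc j) (r ∷ rs) = r ∷ popRow j rs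

  pushRow : ℕ → ℕ → Tableau → Tableau
  pushRow zero x [] = (x ∷ []) ∷ []
  pushRow zero x (r ∷ rs) = (r ++ x ∷ []) ∷ rs
  pushRow (suc j) x [] = []
  pushRow (suc j) x (r ∷ rs) = r ∷ pushRow j x rs

  rowOf : ℕ → Tableau → ℕ
  rowOf n [] = 0
  rowOf n (r ∷ rs) = if does (n ∈? r) then 0 else suc (rowOf n rs)

  All-<-upTo : ∀ m → All (_< m) (upTo m)
  All-<-upTo m = All.tabulate (λ x∈ → ∈-upTo⁻ x∈)

  entries< : ∀ T m → concat T ↭ upTo m → All (All (_< m)) T
  entries< T m p = concat⁻ (All-resp-↭ (↭-sym p) (All-<-upTo m))

  rowOf-spec : ∀ n T → n ∈ concat T → (rowOf n T < length T) × (n ∈ rowAt (rowOf n T) T)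
  rowOf-spec n (r ∷ rs) h with n ∈? r
  ... | yes p = s≤s z≤n , p
  ... | no np with ∈-++⁻ r h
  ...   | inj₁ h' = ⊥-elim (np h')
  ...   | inj₂ h' = s<s (proj₁ (rowOf-spec n rs h')) , proj₂ (rowOf-spec n rs h')

  row-ends-with-max : ∀ r n → Linked _<_ r → n ∈ r → All (_< suc n) r → ∃ λ r' → r ≡ r' ++ n ∷ []
  row-ends-with-max (x ∷ []) n l (here refl) _ = [] , refl
  row-ends-with-max (x ∷ []) n l (there ()) _
  row-ends-with-max (x ∷ y ∷ ys) n (h ∷ l) (here refl) (_ ∷ yl ∷ _) = ⊥-elim (<⇒≱ h (≤-pred yl))
  row-ends-with-max (x ∷ y ∷ ys) n (h ∷ l) (there m) (_ ∷ al) with row-ends-with-max (y ∷ ys) n l m al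
  ... | r' , e = x ∷ r' , cong (x ∷_) e

  dropLast-∷ʳ : ∀ r' n → dropLast (r' ++ n ∷ []) ≡ r'
  dropLast-∷ʳ [] n = refl
  dropLast-∷ʳ (x ∷ []) n = refl
  dropLast-∷ʳ (x ∷ y ∷ ys) n = cong (x ∷_) (dropLast-∷ʳ (y ∷ ys) n)

  NonEmpty : List ℕ → Set
  NonEmpty [] = ⊥
  NonEmpty (_ ∷ _) = ⊤

  nonEmptyRows : ∀ T → Pos (map length T) → All NonEmpty T
  nonEmptyRows [] _ = []
  nonEmptyRows ([] ∷ rs) (() ∷ _)
  nonEmptyRows ((x ∷ r) ∷ rs) (_ ∷ ps) = tt ∷ nonEmptyRows rs ps

  AboveHead : List ℕ → Tableau → Set
  AboveHead p [] = ⊤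
  AboveHead p (r ∷ _) = Above p r

  LinkedAbove-∷ : ∀ p T → AboveHead p T → Linked Above T → Linked Above (p ∷ T)
  LinkedAbove-∷ p [] _ _ = [-]
  LinkedAbove-∷ p (r ∷ rs) h l = h ∷ l

  LinkedAbove-head : ∀ p T → Linked Above (p ∷ T) → AboveHead p T
  LinkedAbove-head p [] _ = tt
  LinkedAbove-head p (r ∷ rs) (h ∷ _) = h

  LinkedAbove-tail : ∀ p T → Linked Above (p ∷ T) → Linked Above T
  LinkedAbove-tail p [] _ = []
  LinkedAbove-tail p (r ∷ rs) (_ ∷ l) = l

  singleton-row-is-last : ∀ j T n → Linked Above T → All (All (_< suc n)) T → All NonEmpty T → rowAt j T ≡ n ∷ [] → j < length T → length T ≡ suc j
  singleton-row-is-last zero (r ∷ []) n _ _ _ _ _ = refl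
  singleton-row-is-last zero (r ∷ [] ∷ rs) n _ _ (_ ∷ () ∷ _) _ _
  singleton-row-is-last zero (r ∷ (y ∷ ys) ∷ rs) n (ab ∷ _) (_ ∷ (yl ∷ _) ∷ _) _ refl _ = ⊥-elim (<⇒≱ (proj₁ ab) (≤-pred yl))
  singleton-row-is-last (suc j) (r ∷ rs) n l (_ ∷ al) (_ ∷ nl) e (s<s lt) = cong suc (singleton-row-is-last j rs n (LinkedAbove-tail r rs l) al nl e lt)

  pushRow-popRow : ∀ j T r' n → rowAt j T ≡ r' ++ n ∷ [] → j < length T → (r' ≡ [] → length T ≡ suc j) → pushRow j n (popRow j T) ≡ T
  pushRow-popRow zero (.(r' ++ n ∷ []) ∷ rs) r' n refl _ lst rewrite dropLast-∷ʳ r' n = go r' rs lst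
    where
    go : ∀ r' rs → (r' ≡ [] → length ((r' ++ n ∷ []) ∷ rs) ≡ 1) → pushRow zero n (consNonEmpty r' rs) ≡ (r' ++ n ∷ []) ∷ rs
    go [] [] _ = refl
    go [] (s ∷ ss) lst' with lst' refl
    ... | ()
    go (x ∷ xs) _ _ = refl
  pushRow-popRow (suc j) (r ∷ rs) r' n e (s<s lt) lst = cong (r ∷_) (pushRow-popRow j rs r' n e lt (λ z → suc-injective (lst z)))

  popRow-pushRow : ∀ j T n → All NonEmpty T → j ≤ length T → popRow j (pushRow j n T) ≡ T
  popRow-pushRow zero [] n _ _ = refl
  popRow-pushRow zero ((x ∷ xs) ∷ rs) n _ _ rewrite dropLast-∷ʳ (x ∷ xs) n = refl
  popRow-pushRow zero ([] ∷ rs) n (() ∷ _) _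
  popRow-pushRow (suc j) (r ∷ rs) n (_ ∷ ne) (s≤s le) = cong (r ∷_) (popRow-pushRow j rs n ne le)

  length-dropLast : ∀ r → length (dropLast r) ≡ pred (length r)
  length-dropLast [] = refl
  length-dropLast (x ∷ []) = refl
  length-dropLast (x ∷ y ∷ ys) = cong suc (length-dropLast (y ∷ ys))

  lengths-consNonEmpty : ∀ xs rs → map length (consNonEmpty xs rs) ≡ consPos (length xs) (map length rs)
  lengths-consNonEmpty [] rs = refl
  lengths-consNonEmpty (x ∷ xs) rs = refl

  lengths-popRow : ∀ j T → map length (popRow j T) ≡ removeAt j (map length T)
  lengths-popRow zero [] = refl
  lengths-popRow (suc j) [] = refl
  lengths-popRow zero (r ∷ rs) = trans (lengths-consNonEmpty (dropLast r) rs) (cong (λ z → consPos z (map length rs)) (length-dropLast r))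
  lengths-popRow (suc j) (r ∷ rs) = cong (length r ∷_) (lengths-popRow j rs)

  lengths-pushRow : ∀ j x T → map length (pushRow j x T) ≡ addAt j (map length T)
  lengths-pushRow zero x [] = refl
  lengths-pushRow zero x (r ∷ rs) = cong (_∷ map length rs) (trans (length-++ r) (+-comm (length r) 1))
  lengths-pushRow (suc j) x [] = refl
  lengths-pushRow (suc j) x (r ∷ rs) = cong (length r ∷_) (lengths-pushRow j x rs)

  toShape-lengths : ∀ T j → toShape (map length T) j ≡ length (rowAt j T)
  toShape-lengths [] j = refl
  toShape-lengths (r ∷ rs) zero = refl
  toShape-lengths (r ∷ rs) (suc j) = toShape-lengths rs j

  Above-length : ∀ a b → Above a b → length b ≤ length a
  Above-length a [] _ = z≤n
  Above-length [] (y ∷ b) ()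
  Above-length (x ∷ a) (y ∷ b) (_ , h) = s≤s (Above-length a b h)

  Above-++ʳ : ∀ a b c → Above a b → Above (a ++ c) b
  Above-++ʳ a [] c _ = tt
  Above-++ʳ [] (y ∷ b) c ()
  Above-++ʳ (x ∷ a) (y ∷ b) c (h , t) = h , Above-++ʳ a b c t

  Above-prefixʳ : ∀ a b c → Above a (b ++ c) → Above a b
  Above-prefixʳ a [] c _ = tt
  Above-prefixʳ [] (y ∷ b) c ()
  Above-prefixʳ (x ∷ a) (y ∷ b) c (h , t) = h , Above-prefixʳ a b c t

  Above-dropLast : ∀ r' n s → Above (r' ++ n ∷ []) s → All (_< suc n) s → Above r' s
  Above-dropLast r' n [] _ _ = tt
  Above-dropLast [] n (y ∷ ys) (h , _) (yl ∷ _) = ⊥-elim (<⇒≱ h (≤-pred yl))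
  Above-dropLast (x ∷ r'') n (y ∷ ys) (h , t) (_ ∷ al) = h , Above-dropLast r'' n ys t al

  Above-∷ʳ : ∀ p r x → Above p r → length r < length p → All (_< x) p → Above p (r ++ x ∷ [])
  Above-∷ʳ (q ∷ qs) [] x _ _ (qx ∷ _) = qx , tt
  Above-∷ʳ (q ∷ qs) (y ∷ ys) x (h , t) (s<s lt) (_ ∷ al) = h , Above-∷ʳ qs ys x t lt al
  Above-∷ʳ [] r x _ () _

  Above-[] : ∀ p s → Above [] s → Above p s
  Above-[] p [] _ = tt
  Above-[] p (_ ∷ _) ()

  AboveHead-popRow : ∀ p j T r' n → AboveHead p T → Linked Above T → All (All (_< suc n)) T → rowAt j T ≡ r' ++ n ∷ [] → AboveHead p (popRow j T)
  AboveHead-popRow p zero (.(r' ++ n ∷ []) ∷ rs) r' n ah l al refl rewrite dropLast-∷ʳ r' n = go r' rs ah l al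
    where
    go : ∀ r' rs → AboveHead p ((r' ++ n ∷ []) ∷ rs) → Linked Above ((r' ++ n ∷ []) ∷ rs) → All (All (_< suc n)) ((r' ++ n ∷ []) ∷ rs) → AboveHead p (consNonEmpty r' rs)
    go [] [] _ _ _ = tt
    go [] (s ∷ ss) _ (ab ∷ _) (_ ∷ (as ∷ _)) = Above-[] p s (Above-dropLast [] n s ab as)
    go (x ∷ xs) _ ah' _ _ = Above-prefixʳ p (x ∷ xs) (n ∷ []) ah'
  AboveHead-popRow p (suc j) (r ∷ rs) r' n ah l al e = ah
  AboveHead-popRow p zero [] r' n ah l al e = tt
  AboveHead-popRow p (suc j) [] r' n ah l al e = tt

  LinkedAbove-popRow : ∀ j T r' n → Linked Above T → All (All (_< suc n)) T → rowAt j T ≡ r' ++ n ∷ [] → Linked Above (popRow j T)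
  LinkedAbove-popRow zero (.(r' ++ n ∷ []) ∷ rs) r' n l al refl rewrite dropLast-∷ʳ r' n = go r' l al
    where
    go : ∀ r' → Linked Above ((r' ++ n ∷ []) ∷ rs) → All (All (_< suc n)) ((r' ++ n ∷ []) ∷ rs) → Linked Above (consNonEmpty r' rs)
    go [] l' _ = LinkedAbove-tail _ rs l'
    go (x ∷ xs) l' al' = LinkedAbove-∷ (x ∷ xs) rs (hd rs l' al') (LinkedAbove-tail _ rs l')
      where
      hd : ∀ rs → Linked Above (((x ∷ xs) ++ n ∷ []) ∷ rs) → All (All (_< suc n)) (((x ∷ xs) ++ n ∷ []) ∷ rs) → AboveHead (x ∷ xs) rs
      hd [] _ _ = tt
      hd (s ∷ ss) (ab ∷ _) (_ ∷ as ∷ _) = Above-dropLast (x ∷ xs) n s ab as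
  LinkedAbove-popRow (suc j) (r ∷ rs) r' n l (_ ∷ al) e =
    LinkedAbove-∷ r (popRow j rs) (AboveHead-popRow r j rs r' n (LinkedAbove-head r rs l) (LinkedAbove-tail r rs l) al e) (LinkedAbove-popRow j rs r' n (LinkedAbove-tail r rs l) al e)
  LinkedAbove-popRow zero [] r' n l al e = []
  LinkedAbove-popRow (suc j) [] r' n l al e = []

  RoomAt : ℕ → Tableau → Set
  RoomAt zero T = ⊤
  RoomAt (suc j) T = length (rowAt (suc j) T) < length (rowAt j T)

  RoomAt-tail : ∀ j r rs → RoomAt (suc j) (r ∷ rs) → RoomAt j rs
  RoomAt-tail zero r rs _ = tt
  RoomAt-tail (suc j) r rs h = h

  AboveHead-pushRow : ∀ p j T n → AboveHead p T → All (_< n) p → (j ≡ 0 → length (rowAt 0 T) < length p) → AboveHead p (pushRow j n T)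
  AboveHead-pushRow (q ∷ qs) zero [] n _ (qn ∷ _) _ = qn , tt
  AboveHead-pushRow [] zero [] n _ _ c with c refl
  ... | ()
  AboveHead-pushRow p zero (r ∷ rs) n ah al c = Above-∷ʳ p r n ah (c refl) al
  AboveHead-pushRow p (suc j) [] n ah al c = tt
  AboveHead-pushRow p (suc j) (r ∷ rs) n ah al c = ah

  LinkedAbove-pushRow : ∀ j T n → Linked Above T → All (All (_< n)) T → RoomAt j T → Linked Above (pushRow j n T)
  LinkedAbove-pushRow zero [] n _ _ _ = [-]
  LinkedAbove-pushRow zero (r ∷ rs) n l _ _ = LinkedAbove-∷ (r ++ n ∷ []) rs (hd rs (LinkedAbove-head r rs l)) (LinkedAbove-tail r rs l)
    where
    hd : ∀ rs → AboveHead r rs → AboveHead (r ++ n ∷ []) rs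
    hd [] _ = tt
    hd (s ∷ ss) h = Above-++ʳ r s (n ∷ []) h
  LinkedAbove-pushRow (suc j) [] n _ _ _ = []
  LinkedAbove-pushRow (suc j) (r ∷ rs) n l (ar ∷ al) sc =
    LinkedAbove-∷ r (pushRow j n rs) (AboveHead-pushRow r j rs n (LinkedAbove-head r rs l) ar (λ { refl → sc })) (LinkedAbove-pushRow j rs n (LinkedAbove-tail r rs l) al (RoomAt-tail j r rs sc))

  Linked-dropLast : ∀ r → Linked _<_ r → Linked _<_ (dropLast r)
  Linked-dropLast [] _ = []
  Linked-dropLast (x ∷ []) _ = []
  Linked-dropLast (x ∷ y ∷ []) _ = [-]
  Linked-dropLast (x ∷ y ∷ z ∷ zs) (h ∷ l) = h ∷ Linked-dropLast (y ∷ z ∷ zs) l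

  Linked-∷ʳ : ∀ r x → Linked _<_ r → All (_< x) r → Linked _<_ (r ++ x ∷ [])
  Linked-∷ʳ [] x _ _ = [-]
  Linked-∷ʳ (y ∷ []) x _ (yx ∷ _) = yx ∷ [-]
  Linked-∷ʳ (y ∷ z ∷ zs) x (h ∷ l) (_ ∷ al) = h ∷ Linked-∷ʳ (z ∷ zs) x l al

  All-consNonEmpty : ∀ {P : List ℕ → Set} xs rs → P xs → All P rs → All P (consNonEmpty xs rs)
  All-consNonEmpty [] rs _ a = a
  All-consNonEmpty (x ∷ xs) rs p a = p ∷ a

  rows-popRow : ∀ j T → All (Linked _<_) T → All (Linked _<_) (popRow j T)
  rows-popRow zero [] _ = []
  rows-popRow (suc j) [] _ = []
  rows-popRow zero (r ∷ rs) (l ∷ ls) = All-consNonEmpty (dropLast r) rs (Linked-dropLast r l) ls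
  rows-popRow (suc j) (r ∷ rs) (l ∷ ls) = l ∷ rows-popRow j rs ls

  rows-pushRow : ∀ j T x → All (Linked _<_) T → All (All (_< x)) T → All (Linked _<_) (pushRow j x T)
  rows-pushRow zero [] x _ _ = [-] ∷ []
  rows-pushRow zero (r ∷ rs) x (l ∷ ls) (a ∷ _) = Linked-∷ʳ r x l a ∷ ls
  rows-pushRow (suc j) [] x _ _ = []
  rows-pushRow (suc j) (r ∷ rs) x (l ∷ ls) (_ ∷ as) = l ∷ rows-pushRow j rs x ls as

  All-rowAt : ∀ {P : List ℕ → Set} j T → P [] → All P T → P (rowAt j T)
  All-rowAt j [] p0 _ = p0
  All-rowAt zero (r ∷ rs) p0 (p ∷ _) = p
  All-rowAt (suc j) (r ∷ rs) p0 (_ ∷ ps) = All-rowAt j rs p0 ps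

  LinkedAbove-rowAt : ∀ j T → Linked Above T → Above (rowAt j T) (rowAt (suc j) T)
  LinkedAbove-rowAt j [] _ = tt
  LinkedAbove-rowAt zero (r ∷ []) _ = tt
  LinkedAbove-rowAt zero (r ∷ s ∷ rs) (h ∷ _) = h
  LinkedAbove-rowAt (suc j) (r ∷ rs) l = LinkedAbove-rowAt j rs (LinkedAbove-tail r rs l)

  concat-pushRow : ∀ j T x → j ≤ length T → concat (pushRow j x T) ↭ concat T ++ x ∷ []
  concat-pushRow zero [] x _ = ↭-refl
  concat-pushRow zero (r ∷ rs) x _ = ↭-trans (↭-reflexive (++-assoc r (x ∷ []) (concat rs)))
    (↭-trans (++⁺ˡ r (++-comm (x ∷ []) (concat rs))) (↭-reflexive (sym (++-assoc r (concat rs) (x ∷ [])))))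
  concat-pushRow (suc j) (r ∷ rs) x (s≤s le) = ↭-trans (++⁺ˡ r (concat-pushRow j rs x le)) (↭-reflexive (sym (++-assoc r (concat rs) (x ∷ []))))

  ≤length-popRow : ∀ j T → j < length T → j ≤ length (popRow j T)
  ≤length-popRow zero T _ = z≤n
  ≤length-popRow (suc j) (r ∷ rs) (s<s lt) = s≤s (≤length-popRow j rs lt)

  rowOf-pushRow : ∀ j T n → All (All (_< n)) T → j ≤ length T → rowOf n (pushRow j n T) ≡ j
  rowOf-pushRow zero [] n _ _ rewrite dec-true (n ∈? (n ∷ [])) (here refl) = refl
  rowOf-pushRow zero (r ∷ rs) n _ _ rewrite dec-true (n ∈? (r ++ n ∷ [])) (∈-++⁺ʳ r (here refl)) = refl
  rowOf-pushRow (suc j) (r ∷ rs) n (ar ∷ al) (s≤s le) rewrite dec-false (n ∈? r) (λ m → <-irrefl refl (All.lookup ar m)) =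
    cong suc (rowOf-pushRow j rs n al le)

module Counting (M : ℕ) where

  open import Data.Nat
  open import Data.Nat.Properties
  open import Data.Nat.ListAction using (sum)
  open import Data.List using (List; []; _∷_; length; map; concat; upTo; _++_; filter)
  open import Data.List.Properties using (length-++; length-map; ++-identityʳ; upTo-∷ʳ; filter-none)
  open import Data.List.Relation.Unary.All using (All; []; _∷_)
  import Data.List.Relation.Unary.All as All
  open import Data.List.Relation.Unary.AllPairs using ([]; _∷_)
  open import Data.List.Relation.Unary.Unique.Propositional using (Unique)
  import Data.List.Relation.Unary.Unique.Propositional.Properties as Unique
  open import Data.List.Relation.Unary.Any using (here; there)
  open import Data.List.Relation.Unary.Linked using ([])
  open import Data.List.Membership.Propositional using (_∈_)
  open import Data.List.Membership.Propositional.Properties using (∈-upTo⁺; ∈-map⁺; ∈-map⁻; ∈-filter⁺; ∈-filter⁻)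
  open import Data.List.Relation.Binary.Permutation.Propositional using (_↭_; ↭-sym; ↭-trans; ↭-refl; ↭-reflexive)
  open import Data.List.Relation.Binary.Permutation.Propositional.Properties using (∈-resp-↭; ++⁺ʳ; drop-mid)
  open import Data.Bool using (true; false)
  open import Data.Empty using (⊥-elim)
  open import Data.Unit using (tt)
  open import Data.Product using (_×_; _,_; proj₁; proj₂; ∃)
  open import Function.Bundles using (_⇔_; mk⇔; Equivalence)
  open import Relation.Binary.PropositionalEquality
  open import Relation.Nullary using (does)
  open import Defs
  open RangeSum
  open YoungLattice M
  open DownUp M using (pred<)
  open ListShape M
  open Tableaux M
  open UpperBound M using (f-0-empty)

  module _ {A : Set} where

    length-filter-∷ : ∀ (key : A → ℕ) j x xs →
      length (filter (λ y → key y ≟ j) (x ∷ xs)) ≡ 𝟙 (does (key x ≟ j)) + length (filter (λ y → key y ≟ j) xs)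
    length-filter-∷ key j x xs with does (key x ≟ j)
    ... | true  = refl
    ... | false = refl

    ∑-𝟙-≟ : ∀ K x → x < K → ∑[ j < K ] 𝟙 (does (x ≟ j)) ≡ 1
    ∑-𝟙-≟ (suc K) zero    _         = cong suc (∑-zero K)
    ∑-𝟙-≟ (suc K) (suc x) (s<s x<K) = ∑-𝟙-≟ K x x<K

    length≡∑-length-filter : ∀ (key : A → ℕ) K xs → All (λ x → key x < K) xs →
      length xs ≡ ∑[ j < K ] length (filter (λ x → key x ≟ j) xs)
    length≡∑-length-filter key K []       _          = sym (∑-zero K)
    length≡∑-length-filter key K (x ∷ xs) (x<K ∷ ps) = sym (begin
        ∑[ j < K ] length (filter (λ y → key y ≟ j) (x ∷ xs))
      ≡⟨ ∑-cong K (λ j _ → length-filter-∷ key j x xs) ⟩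
        ∑[ j < K ] (𝟙 (does (key x ≟ j)) + length (filter (λ y → key y ≟ j) xs))
      ≡⟨ ∑-+ K (λ j → 𝟙 (does (key x ≟ j))) (λ j → length (filter (λ y → key y ≟ j) xs)) ⟩
        ∑[ j < K ] 𝟙 (does (key x ≟ j)) + ∑[ j < K ] length (filter (λ y → key y ≟ j) xs)
      ≡⟨ cong₂ _+_ (∑-𝟙-≟ K (key x) x<K) (sym (length≡∑-length-filter key K xs ps)) ⟩
        suc (length xs)
      ∎) where open ≡-Reasoning

    Unique-map-retraction : ∀ (g h : A → A) xs → All (λ x → h (g x) ≡ x) xs → Unique xs → Unique (map g xs)
    Unique-map-retraction g h []       _        _        = []
    Unique-map-retraction g h (x ∷ xs) (hgx ∷ hg) (x∉ ∷ u) = distinct xs hg x∉ ∷ Unique-map-retraction g h xs hg u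
      where
      distinct : ∀ ys → All (λ y → h (g y) ≡ y) ys → All (x ≢_) ys → All (g x ≢_) (map g ys)
      distinct []       _            _            = []
      distinct (y ∷ ys) (hgy ∷ hgys) (x≢y ∷ x≢ys) =
        (λ gx≡gy → x≢y (trans (sym hgx) (trans (cong h gx≡gy) hgy))) ∷ distinct ys hgys x≢ys

    length≡1 : ∀ (x : A) xs → Unique xs → (∀ y → y ∈ xs → y ≡ x) → x ∈ xs → length xs ≡ 1
    length≡1 x (y ∷ [])     _                 _   _ = refl
    length≡1 x (y ∷ z ∷ zs) ((y≢z ∷ _) ∷ _) all≡x _ = ⊥-elim (y≢z (trans (all≡x y (here refl)) (sym (all≡x z (there (here refl))))))

  largest-ends-row : ∀ n λp T → IsPartition (suc n) λp → IsSYT λp (suc n) T →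
    rowOf n T < length T × ∃ (λ r → rowAt (rowOf n T) T ≡ r ++ n ∷ [])
  largest-ends-row n λp T _ (_ , perm , rl , _) =
    proj₁ (rowOf-spec n T n∈T) ,
    row-ends-with-max (rowAt j T) n (All-rowAt j T [] rl) (proj₂ (rowOf-spec n T n∈T)) (All-rowAt j T [] (entries< T (suc n) perm))
    where
    j = rowOf n T
    n∈T : n ∈ concat T
    n∈T = ∈-resp-↭ (↭-sym perm) (∈-upTo⁺ (n<1+n n))

  removable-rowOfLargest : ∀ n λp T → (p : IsPartition (suc n) λp) → (t : IsSYT λp (suc n) T) → removable (toShape λp) (rowOf n T) ≡ true
  removable-rowOfLargest n λp T p t@(ml , perm , _ , la) with largest-ends-row n λp T p t
  ... | _ , r , row≡r∷ʳn =
    subst (λ z → removable (toShape z) j ≡ true) ml (<⇒<ᵇ≡true (subst₂ _<_ (sym (toShape-lengths T (suc j))) (sym (toShape-lengths T j)) shorter))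
    where
    j = rowOf n T
    s = rowAt (suc j) T
    shorter : length s < length (rowAt j T)
    shorter = subst (λ z → length s < length z) (sym row≡r∷ʳn)
      (≤-<-trans (Above-length r s (Above-dropLast r n s (subst (λ z → Above z s) row≡r∷ʳn (LinkedAbove-rowAt j T la))
                                                        (All-rowAt (suc j) T [] (entries< T (suc n) perm))))
                 (subst (length r <_) (sym (trans (length-++ r) (+-comm (length r) 1))) (n<1+n _)))

  pushRow-popLargest : ∀ n λp T → IsPartition (suc n) λp → IsSYT λp (suc n) T → pushRow (rowOf n T) n (popRow (rowOf n T) T) ≡ T
  pushRow-popLargest n λp T p@(_ , ps , _) t@(ml , perm , _ , la) with largest-ends-row n λp T p t
  ... | j<len , r , row≡r∷ʳn = pushRow-popRow (rowOf n T) T r n row≡r∷ʳn j<len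
    (λ r≡[] → singleton-row-is-last (rowOf n T) T n la (entries< T (suc n) perm) (nonEmptyRows T (subst Pos (sym ml) ps))
                (trans row≡r∷ʳn (cong (_++ n ∷ []) r≡[])) j<len)

  SYT-popLargest : ∀ n λp T → IsPartition (suc n) λp → IsSYT λp (suc n) T → IsSYT (removeAt (rowOf n T) λp) n (popRow (rowOf n T) T)
  SYT-popLargest n λp T p t@(ml , perm , rl , la) with largest-ends-row n λp T p t
  ... | j<len , r , row≡r∷ʳn = shape , perm′ , rows-popRow j T rl , LinkedAbove-popRow j T r n la (entries< T (suc n) perm) row≡r∷ʳn
    where
    j = rowOf n T
    shape : map length (popRow j T) ≡ removeAt j λp
    shape = trans (lengths-popRow j T) (cong (removeAt j) ml)
    perm∷ʳn : concat (popRow j T) ++ n ∷ [] ↭ upTo n ++ n ∷ []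
    perm∷ʳn = ↭-trans (↭-sym (concat-pushRow j (popRow j T) n (≤length-popRow j T j<len)))
      (↭-trans (↭-reflexive (cong concat (pushRow-popLargest n λp T p t))) (↭-trans perm (↭-reflexive (sym (upTo-∷ʳ n)))))
    perm′ : concat (popRow j T) ↭ upTo n
    perm′ = subst₂ _↭_ (++-identityʳ _) (++-identityʳ _) (drop-mid (concat (popRow j T)) (upTo n) {[]} {[]} perm∷ʳn)

  SYT-pushLargest : ∀ n λp j T' → IsPartition (suc n) λp → removable (toShape λp) j ≡ true → IsSYT (removeAt j λp) n T' →
    IsSYT λp (suc n) (pushRow j n T') × (rowOf n (pushRow j n T') ≡ j) × (popRow j (pushRow j n T') ≡ T')
  SYT-pushLargest n λp j T' (lk , ps , sm) r (ml , perm , rl , la) = (shape , perm' , rows , la') , rowOf-pushRow j T' n al jle , popRow-pushRow j T' n ne jle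
    where
    λf = toShape λp
    al : All (All (_< n)) T'
    al = entries< T' n perm
    ne : All NonEmpty T'
    ne = nonEmptyRows T' (subst Pos (sym ml) (removeAt-pos λp j ps))
    jle : j ≤ length T'
    jle = subst (j ≤_) (trans (cong length (sym ml)) (length-map length T')) (≤length-removeAt λp j (removable⇒<length λp j r))
    shape : map length (pushRow j n T') ≡ λp
    shape = trans (lengths-pushRow j n T') (trans (cong (addAt j) ml) (addAt-removeAt λp j ps r))
    perm' : concat (pushRow j n T') ↭ upTo (suc n)
    perm' = ↭-trans (concat-pushRow j T' n jle) (↭-trans (++⁺ʳ (n ∷ []) perm) (↭-reflexive (upTo-∷ʳ n)))
    rows = rows-pushRow j T' n rl al
    lenAt : ∀ x → length (rowAt x T') ≡ removeCell λf j x
    lenAt x = trans (sym (toShape-lengths T' x)) (trans (cong (λ z → toShape z x) ml) (toShape-removeAt λp j ps r x))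
    room : ∀ j → removable λf j ≡ true → (∀ x → length (rowAt x T') ≡ removeCell λf j x) → RoomAt j T'
    room zero     _ _     = tt
    room (suc j′) r lenAt = subst₂ _<_ (sym (trans (lenAt (suc j′)) (removeCell-at λf (suc j′))))
      (sym (trans (lenAt j′) (removeCell-above λf j′)))
      (<-≤-trans (pred< (removable⇒pos λf (suc j′) r)) (toShape-decreasing λp lk j′))
    la' = LinkedAbove-pushRow j T' n la al (room j r lenAt)

  CountsSYT : ℕ → Set
  CountsSYT n = ∀ λp → IsPartition n λp → ∀ L → Unique L → (∀ T → IsSYT λp n T ⇔ T ∈ L) → length L ≡ f n (toShape λp)

  -- Removing the largest entry is a bijection between the tableaux of shape λ with n in
  -- row j and the tableaux of shape λ minus the corner of row j.
  count-largest-in-row : ∀ n λp j L → suc n ≤ M → CountsSYT n → IsPartition (suc n) λp → Unique L →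
    (∀ T → IsSYT λp (suc n) T ⇔ T ∈ L) → length (filter (λ T → rowOf n T ≟ j) L) ≡ cornerTerm n (toShape λp) j
  count-largest-in-row n λp j L le count part u ch with removable (toShape λp) j in r
  ... | false = cong length (filter-none (λ T → rowOf n T ≟ j) {L} (All.tabulate λ {T} T∈L rowT≡j →
    true≢false (trans (sym (subst (λ z → removable (toShape λp) z ≡ true) rowT≡j
                                  (removable-rowOfLargest n λp T part (Equivalence.from (ch T) T∈L)))) r)))
    where
    true≢false : true ≢ false
    true≢false ()
  ... | true  = trans (sym (length-map (popRow j) Lj))
    (trans (count (removeAt j λp) (IsPartition-removeAt n λp j part r) L′ unique′ char′)
           (f-cong n _ _ (toShape-removeAt λp j (proj₁ (proj₂ part)) r)))
    where
    Lj = filter (λ T → rowOf n T ≟ j) L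
    L′ = map (popRow j) Lj
    member : ∀ {T} → T ∈ Lj → IsSYT λp (suc n) T × rowOf n T ≡ j
    member T∈Lj = Equivalence.from (ch _) (proj₁ (∈-filter⁻ (λ T → rowOf n T ≟ j) {xs = L} T∈Lj)) ,
                  proj₂ (∈-filter⁻ (λ T → rowOf n T ≟ j) {xs = L} T∈Lj)
    unique′ : Unique L′
    unique′ = Unique-map-retraction (popRow j) (pushRow j n) Lj
      (All.tabulate λ {T} T∈Lj → subst (λ z → pushRow z n (popRow z T) ≡ T) (proj₂ (member T∈Lj)) (pushRow-popLargest n λp T part (proj₁ (member T∈Lj))))
      (Unique.filter⁺ (λ T → rowOf n T ≟ j) u)
    char′ : ∀ T′ → IsSYT (removeAt j λp) n T′ ⇔ T′ ∈ L′
    char′ T′ = mk⇔ to from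
      where
      to : IsSYT (removeAt j λp) n T′ → T′ ∈ L′
      to t′ with SYT-pushLargest n λp j T′ part r t′
      ... | t , rowOf≡j , pop∘push = subst (_∈ L′) pop∘push
        (∈-map⁺ (popRow j) (∈-filter⁺ (λ T → rowOf n T ≟ j) (Equivalence.to (ch (pushRow j n T′)) t) rowOf≡j))
      from : T′ ∈ L′ → IsSYT (removeAt j λp) n T′
      from T′∈L′ with ∈-map⁻ (popRow j) T′∈L′
      ... | T , T∈Lj , refl = subst (λ z → IsSYT (removeAt z λp) n (popRow z T)) (proj₂ (member T∈Lj)) (SYT-popLargest n λp T part (proj₁ (member T∈Lj)))

  length≡f : ∀ n → n ≤ M → CountsSYT n
  length≡f zero _ (a ∷ as) (_ , (0<a ∷ _) , sum≡0) L u ch = ⊥-elim (<⇒≢ (≤-trans 0<a (m≤m+n a (sum as))) (sym sum≡0))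
  length≡f zero _ [] _ L u ch = trans (length≡1 [] L u (λ T T∈L → empty T (proj₁ (Equivalence.from (ch T) T∈L))) []∈L)
                                      (sym (f-0-empty (toShape []) (λ _ → refl)))
    where
    []∈L : [] ∈ L
    []∈L = Equivalence.to (ch []) (refl , ↭-refl , [] , [])
    empty : ∀ (T : List (List ℕ)) → map length T ≡ [] → T ≡ []
    empty [] _ = refl
  length≡f (suc n) le λp part L u ch = begin
      length L
    ≡⟨ length≡∑-length-filter (rowOf n) N L (All.tabulate (λ {T} T∈L → rowOf<N T (Equivalence.from (ch T) T∈L))) ⟩
      ∑[ j < N ] length (filter (λ T → rowOf n T ≟ j) L)
    ≡⟨ ∑-cong N (λ j _ → count-largest-in-row n λp j L le (length≡f n (≤-trans (n≤1+n n) le)) part u ch) ⟩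
      f (suc n) (toShape λp)
    ∎
    where
    open ≡-Reasoning
    rowOf<N : ∀ T → IsSYT λp (suc n) T → rowOf n T < N
    rowOf<N T t = <-≤-trans (proj₁ (largest-ends-row n λp T part t))
      (subst (_≤ N) (trans (cong length (sym (proj₁ t))) (length-map length T))
             (≤-trans (subst (length λp ≤_) (proj₂ (proj₂ part)) (length≤sum λp (proj₁ (proj₂ part)))) (m≤n⇒m≤1+n le)))

module Arithmetic where

  open import Data.Nat
  open import Data.Nat.Properties
  open import Data.Bool.Properties using (T-≡)
  open import Data.Nat.Combinatorics using (_C_; nCk≡nPk/k!; k>n⇒nCk≡0)
  open import Data.Nat.Combinatorics.Base using (_P′_)
  open import Data.Nat.Combinatorics.Specification using (k!∣nP′k)
  open import Data.Nat.DivMod using (m/n*n≡m)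
  open import Data.Nat.Solver using (module +-*-Solver)
  open import Function.Bundles using (Equivalence)
  open import Relation.Binary.PropositionalEquality
  open import Relation.Nullary using (yes; no)
  open +-*-Solver

  nP′k≤n^k : ∀ n k → n P′ k ≤ n ^ k
  nP′k≤n^k n zero    = ≤-refl
  nP′k≤n^k n (suc k) = *-mono-≤ (m∸n≤m n k) (nP′k≤n^k n k)

  nCk*k!≤n^k : ∀ n k → (n C k) * k ! ≤ n ^ k
  nCk*k!≤n^k n k with k ≤? n
  ... | no k≰n = subst (λ c → c * k ! ≤ n ^ k) (sym (k>n⇒nCk≡0 (≰⇒> k≰n))) z≤n
  ... | yes k≤n = subst (_≤ n ^ k) (sym nCk*k!≡nP′k) (nP′k≤n^k n k)
    where
    nCk*k!≡nP′k : (n C k) * k ! ≡ n P′ k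
    nCk*k!≡nP′k rewrite nCk≡nPk/k! k≤n | Equivalence.to T-≡ (≤⇒≤ᵇ k≤n) = m/n*n≡m {{k !≢0}} (k!∣nP′k k≤n)

  square-bound : ∀ n k x c g → x ≤ c * g → g * g ≤ k ! → c * k ! ≤ n ^ k → x ^ 2 * k ! ≤ n ^ (2 * k)
  square-bound n k x c g x≤cg g²≤k! ck!≤nᵏ = begin
      x * (x * 1) * k !
    ≤⟨ *-monoˡ-≤ (k !) (*-mono-≤ x≤cg (*-monoˡ-≤ 1 x≤cg)) ⟩
      (c * g) * ((c * g) * 1) * k !
    ≡⟨ solve 3 (λ c g t → ((c :* g) :* ((c :* g) :* con 1)) :* t := (c :* c) :* ((g :* g) :* t)) refl c g (k !) ⟩
      (c * c) * ((g * g) * k !)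
    ≤⟨ *-monoʳ-≤ (c * c) (*-monoˡ-≤ (k !) g²≤k!) ⟩
      (c * c) * (k ! * k !)
    ≡⟨ solve 2 (λ c t → (c :* c) :* (t :* t) := (c :* t) :* ((c :* t) :* con 1)) refl c (k !) ⟩
      (c * k !) * ((c * k !) * 1)
    ≤⟨ *-mono-≤ ck!≤nᵏ (*-monoˡ-≤ 1 ck!≤nᵏ) ⟩
      n ^ k * (n ^ k * 1)
    ≡⟨ cong (n ^ k *_) (trans (*-identityʳ (n ^ k)) (cong (n ^_) (sym (+-identityʳ k)))) ⟩
      n ^ k * n ^ (k + 0)
    ≡⟨ sym (^-distribˡ-+-* n k (k + 0)) ⟩
      n ^ (2 * k)
    ∎ where open ≤-Reasoning

module PartitionBounds (n : ℕ) where

  open import Data.Nat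
  open import Data.Nat.Properties
  open import Data.Nat.Combinatorics using (_C_)
  open import Data.List using (List; length)
  open import Data.Product using (_×_; _,_; proj₁; proj₂)
  open import Data.Sum using (inj₁; inj₂)
  open import Function using (_∘_)
  open import Relation.Binary.PropositionalEquality
  open RangeSum
  open YoungLattice (suc n)
  open SquareBound (suc n)
  open UpperBound (suc n)
  open LowerBound (suc n)
  open ListShape (suc n)
  open Arithmetic

  Bounds : ℕ → ℕ → Set
  Bounds k x = (x ^ 2 * k ! ≤ n ^ (2 * k)) × ((n ∸ k) C k ≤ x)

  bounds : ∀ k x μ → k ≤ n → Decreasing μ → x ≤ (n C k) * f k μ → (n ∸ k) C k ≤ x → Bounds k x
  bounds k x μ k≤n P upper lower =
    square-bound n k x (n C k) (f k μ) upper (f²≤! k μ P (m≤n⇒m≤1+n k≤n)) (nCk*k!≤n^k n k) , lower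

  module _ (λp : List ℕ) (part : IsPartition n λp) where

    private
      κ : Shape
      κ = toShape λp

      length≤n : length λp ≤ n
      length≤n = subst (length λp ≤_) (proj₂ (proj₂ part)) (length≤sum λp (proj₁ (proj₂ part)))

      decreasing : Decreasing κ
      decreasing = toShape-decreasing λp (proj₁ part)

      vanishes : VanishesFrom (suc n) κ
      vanishes x n<x = toShape-vanishes λp x (≤-trans length≤n (<⇒≤ n<x))

      size≡n : size κ ≡ n
      size≡n = trans (∑-toShape λp N (≤-trans length≤n (≤-trans (n≤1+n n) (n≤1+n _)))) (proj₂ (proj₂ part))

      width≤n : κ 0 ≤ n
      width≤n = subst (κ 0 ≤_) size≡n (term≤∑ N κ 0 z<s)

      hasLength : HasLength κ (length λp)
      hasLength = toShape-vanishes λp (length λp) ≤-refl , toShape-pos λp (proj₁ (proj₂ part))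

    firstRowBounds : Bounds (n ∸ κ 0) (f n κ)
    firstRowBounds = bounds (n ∸ κ 0) (f n κ) (dropFirstRow κ) (m∸n≤m n (κ 0)) (decreasing ∘ suc)
      (f≤C*f-dropFirstRow n (n ∸ κ 0) κ decreasing (m∸n+n≡m width≤n))
      (subst (λ w → w C (n ∸ κ 0) ≤ f n κ) (sym (m∸[m∸n]≡n width≤n))
             (C≤f-firstRow n (s≤s z≤n) (n ∸ κ 0) κ decreasing vanishes size≡n (m∸n+n≡m width≤n)))

    firstColumnBounds : Bounds (n ∸ length λp) (f n κ)
    firstColumnBounds = bounds (n ∸ length λp) (f n κ) (dropFirstColumn κ) (m∸n≤m n (length λp)) (∸-monoˡ-≤ 1 ∘ decreasing)
      (f≤C*f-dropFirstColumn n (n ∸ length λp) κ (length λp) decreasing hasLength (m∸n+n≡m length≤n))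
      (subst (λ w → w C (n ∸ length λp) ≤ f n κ) (sym (m∸[m∸n]≡n length≤n))
             (C≤f-firstColumn n (n ∸ length λp) κ (length λp) decreasing vanishes hasLength size≡n (m∸n+n≡m length≤n)))

    aftBounds : Bounds (aft n λp) (f n κ)
    aftBounds with ≤-total (length λp) (largestPart λp)
    ... | inj₁ ℓ≤λ₁ = subst (λ m → Bounds (n ∸ m) (f n κ)) (trans (toShape-head λp) (sym (m≥n⇒m⊔n≡m ℓ≤λ₁))) firstRowBounds
    ... | inj₂ λ₁≤ℓ = subst (λ m → Bounds (n ∸ m) (f n κ)) (sym (m≤n⇒m⊔n≡n λ₁≤ℓ)) firstColumnBounds

open import Relation.Binary.PropositionalEquality using (subst; sym)
open import Data.Nat using (suc)
open import Data.Nat.Properties using (n≤1+n)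

proposition3p1 : (n : ℕ) (λp : List ℕ) → IsPartition n λp →
    (L : List (List (List ℕ))) → Unique L →
    ((T : List (List ℕ)) → (IsSYT λp n T ⇔ T ∈ L)) →
    ((length L ^ 2) * (aft n λp) ! ≤ n ^ (2 * aft n λp)) ×
    ((n ∸ aft n λp) C (aft n λp) ≤ length L)
proposition3p1 n λp part L uniq ch =
  subst (PartitionBounds.Bounds n (aft n λp)) (sym (Counting.length≡f (suc n) n (n≤1+n n) λp part L uniq ch))
        (PartitionBounds.aftBounds n λp part)
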